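{- In $\mathfrak{H}^1_\diamond[[X,Y]]$ one has $$\frac{1}{1-RX}(1)\diamond\frac{1}{1-RY}(1)=\sum_{\mathbf{k}}z_{\mathbf{k}},$$ where the sum runs over all finite sequences $\mathbf{k}=(k_1,\dots,k_r)$ ($r\ge0$) of positive integers, and $\frac{1}{1-RX}(1)$ means $\sum_{m\ge0}R^m(1)X^m$.
   Context: $\mathfrak{H}=\mathbb{Q}\langle x,y\rangle$, $z=x+y$. The product $\diamond$ on $\mathfrak{H}$ is the $\mathbb{Q}$-bilinear product with $w\diamond1=1\diamond w=w$ and, for $v,w\in\mathfrak{H}$: $vx\diamond wx=(v\diamond wx)x-(vy\diamond w)x$, $vx\diamond wy=(v\diamond wy)x+(vx\diamond w)y$, $vy\diamond wx=(v\diamond wx)y+(vy\diamond w)x$, $vy\diamond wy=(v\diamond wy)y-(vx\diamond w)y$. $\mathfrak{H}^1_\diamond$ is $\mathfrak{H}^1=\mathbb{Q}+\mathfrak{H}y$ with this (associative, commutative) product. $X,Y$ are commuting formal parameters commuting with $x,y$; $\diamond$ and all linear maps are extended $\mathbb{Q}[[X,Y]]$-(bi)linearly coefficientwise. $R=R_yR_{z+y}R_y^{ -1}$ is the linear map on $\mathfrak{H}^1$ with $R(wy)=w(x+2y)y$ for $w\in\mathfrak{H}$, and $R(1)=y$. For $k\ge1$ let $f(k)=X^k+Y^k-\sum_{n=1}^{k-1}X^nY^{k-n}\in\mathbb{Q}[X,Y]$, $z_k=f(k)z^{k-1}y$, $z_{k_1,\dots,k_r}=z_{k_1}\cdots z_{k_r}$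 (concatenation), and $z_\emptyset=1$. -}

module Defs where

open import Data.Nat as ℕ using (ℕ; zero; suc; _∸_; _≡ᵇ_)
open import Data.Rational using (ℚ; 0ℚ; 1ℚ; _+_; _*_; -_)
open import Data.List using (List; []; _∷_; _++_; map; concatMap; foldr; upTo)
open import Data.Product using (_×_; _,_)
open import Data.Bool using (Bool; true; false; _∧_; if_then_else_)
open import Relation.Binary.PropositionalEquality using (_≡_)

-- Words in the letters x, y (snoc-lists: the last letter is outermost)

data Letter : Set where
  𝕩 𝕪 : Letter

infixl 5 _▹_
data Word : Set where
  ε   : Word
  _▹_ : Word → Letter → Word

_·w_ : Word → Word → Word
u ·w ε       = u
u ·w (w ▹ a) = (u ·w w) ▹ a

len : Word → ℕ
len ε       = zero
len (w ▹ _) = suc (len w)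

eqL : Letter → Letter → Bool
eqL 𝕩 𝕩 = true
eqL 𝕪 𝕪 = true
eqL _ _ = false

eqW : Word → Word → Bool
eqW ε ε             = true
eqW (u ▹ a) (v ▹ b) = eqL a b ∧ eqW u v
eqW _ _             = false

-- 𝔥 = ℚ⟨x,y⟩ : finite formal ℚ-linear combinations of words,
-- compared through their coefficient functions.

H : Set
H = List (ℚ × Word)

coeff : H → Word → ℚ
coeff []             w = 0ℚ
coeff ((c , u) ∷ p)  w = (if eqW u w then c else 0ℚ) + coeff p w

infix 4 _≈H_
_≈H_ : H → H → Set
p ≈H q = ∀ w → coeff p w ≡ coeff q w

0H : H
0H = []

1H : H
1H = (1ℚ , ε) ∷ []

infixl 6 _⊕_
_⊕_ : H → H → H
_⊕_ = _++_

scale : ℚ → H → H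
scale c = map (λ { (d , u) → (c * d , u) })

neg : H → H
neg = scale (- 1ℚ)

infixl 7 _·ℓ_
_·ℓ_ : H → Letter → H
p ·ℓ a = map (λ { (c , u) → (c , u ▹ a) }) p

mulH : H → H → H
mulH p q = concatMap (λ { (c , u) → map (λ { (d , v) → (c * d , u ·w v) }) q }) p

-- The product ⋄ on words, by the recursive rules; the fuel argument is
-- the total length |v|+|w| (each recursive call lowers it by one).

diamondF : ℕ → Word → Word → H
diamondF _ ε w = (1ℚ , w) ∷ []
diamondF _ (v ▹ a) ε = (1ℚ , v ▹ a) ∷ []
diamondF zero (v ▹ a) (w ▹ b) = 0H
diamondF (suc n) (v ▹ 𝕩) (w ▹ 𝕩) =
  (diamondF n v (w ▹ 𝕩) ·ℓ 𝕩) ⊕ neg (diamondF n (v ▹ 𝕪) w ·ℓ 𝕩)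
diamondF (suc n) (v ▹ 𝕩) (w ▹ 𝕪) =
  (diamondF n v (w ▹ 𝕪) ·ℓ 𝕩) ⊕ (diamondF n (v ▹ 𝕩) w ·ℓ 𝕪)
diamondF (suc n) (v ▹ 𝕪) (w ▹ 𝕩) =
  (diamondF n v (w ▹ 𝕩) ·ℓ 𝕪) ⊕ (diamondF n (v ▹ 𝕪) w ·ℓ 𝕩)
diamondF (suc n) (v ▹ 𝕪) (w ▹ 𝕪) =
  (diamondF n v (w ▹ 𝕪) ·ℓ 𝕪) ⊕ neg (diamondF n (v ▹ 𝕩) w ·ℓ 𝕪)

diamW : Word → Word → H
diamW v w = diamondF (len v ℕ.+ len w) v w

infixl 7 _⋄_
_⋄_ : H → H → H
p ⋄ q = concatMap (λ { (c , u) → concatMap (λ { (d , v) → scale (c * d) (diamW u v) }) q }) p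

-- R = R_y R_{z+y} R_y⁻¹ on 𝔥¹ : R(1) = y, R(wy) = w(x+2y)y.
-- (Words ending in x lie outside 𝔥¹; R is only ever applied to 𝔥¹ here,
-- and is set to 0 on such words.)

RW : Word → H
RW ε       = (1ℚ , ε ▹ 𝕪) ∷ []
RW (w ▹ 𝕪) = (1ℚ , w ▹ 𝕩 ▹ 𝕪) ∷ (1ℚ + 1ℚ , w ▹ 𝕪 ▹ 𝕪) ∷ []
RW (w ▹ 𝕩) = 0H

RH : H → H
RH p = concatMap (λ { (c , u) → scale c (RW u) }) p

Rpow : ℕ → H → H
Rpow zero    p = p
Rpow (suc m) p = RH (Rpow m p)

-- Formal power series in X, Y over 𝔥: S a b = coefficient of X^a Y^b.

PS : Set
PS = ℕ → ℕ → H

diamPS : PS → PS → PS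
diamPS S T a b =
  concatMap (λ i → concatMap (λ j → S i j ⋄ T (a ∸ i) (b ∸ j)) (upTo (suc b))) (upTo (suc a))

geomRX : PS
geomRX a b = if b ≡ᵇ 0 then Rpow a 1H else 0H

geomRY : PS
geomRY a b = if a ≡ᵇ 0 then Rpow b 1H else 0H

-- Polynomials in X, Y over 𝔥: finite formal sums of terms c X^i Y^j w.

PolyH : Set
PolyH = List (ℚ × ℕ × ℕ × Word)

coeffXY : PolyH → ℕ → ℕ → H
coeffXY []                      a b = 0H
coeffXY ((c , i , j , w) ∷ p)   a b =
  (if (i ≡ᵇ a) ∧ (j ≡ᵇ b) then (c , w) ∷ [] else 0H) ⊕ coeffXY p a b

-- f(k) = X^k + Y^k - Σ_{n=1}^{k-1} X^n Y^{k-n}, as a list of monomials c X^i Y^j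
fpoly : ℕ → List (ℚ × ℕ × ℕ)
fpoly k = (1ℚ , k , 0) ∷ (1ℚ , 0 , k) ∷ map (λ n → (- 1ℚ , n , k ∸ n)) (map suc (upTo (k ∸ 1)))

zH : H
zH = (1ℚ , ε ▹ 𝕩) ∷ (1ℚ , ε ▹ 𝕪) ∷ []

zpow : ℕ → H
zpow zero    = 1H
zpow (suc n) = mulH (zpow n) zH

-- z_k = f(k) z^{k-1} y
zk : ℕ → PolyH
zk k = concatMap (λ { (c , i , j) → map (λ { (d , w) → (c * d , i , j , w) }) (zpow (k ∸ 1) ·ℓ 𝕪) }) (fpoly k)

mulP : PolyH → PolyH → PolyH
mulP p q = concatMap (λ { (c , i , j , u) → map (λ { (d , i' , j' , v) → (c * d , i ℕ.+ i' , j ℕ.+ j' , u ·w v) }) q }) p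

1P : PolyH
1P = (1ℚ , 0 , 0 , ε) ∷ []

zseq : List ℕ → PolyH
zseq = foldr (λ k p → mulP (zk k) p) 1P

incHead : List ℕ → List ℕ
incHead []      = []
incHead (k ∷ ks) = suc k ∷ ks

comps : ℕ → List (List ℕ)
comps zero          = [] ∷ []
comps (suc zero)    = (1 ∷ []) ∷ []
comps (suc (suc n)) = map (1 ∷_) (comps (suc n)) ++ map incHead (comps (suc n))

-- coefficient of X^a Y^b in Σ_𝐤 z_𝐤. Only sequences with |𝐤| ≤ a+b can
-- contribute (z_𝐤 is homogeneous of degree |𝐤| in X,Y); we sum over all of them.
sumZ : PS
sumZ a b = concatMap (λ n → concatMap (λ ks → coeffXY (zseq ks) a b) (comps n)) (upTo (suc (a ℕ.+ b)))

-- Both sides, read as families F a b of coefficients of X^a Y^b, satisfy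
--
--   F a b = Σ_{k<a} F(a-k-1, b) z^k y + Σ_{l<b} F(a, b-l-1) z^l y
--             - Σ_{k<a, l<b} F(a-k-1, b-l-1) z^{k+l+1} y        (a + b > 0)
--
-- with F 0 0 = 1, and this recursion determines F.  On the left,
-- R^{m+1}(1) = Σ_k R^{m-k}(1) z^k y, and since right multiplication by z
-- commutes with ⋄, the defining rules of ⋄ give
--   (u z^k y) ⋄ (w z^l y) = (u ⋄ w z^l y) z^k y + (u z^k y ⋄ w) z^l y - (u ⋄ w) z^{k+l+1} y.
-- On the right, split off the last factor z_{k+1} = f(k+1) z^k y of z_𝐤:
-- the monomials X^{k+1}, Y^{k+1} and -X^n Y^{k+1-n} of f(k+1) produce the
-- three sums.

module Submission where

open import Defs
open import Data.Bool using (Bool; true; false; _∧_; if_then_else_; T)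
open import Data.Bool.Properties using (∧-identityʳ)
open import Data.Empty using (⊥-elim)
open import Data.Unit using (tt)
open import Data.List using (List; []; _∷_; _++_; map; concat; concatMap; upTo; applyUpTo; length)
open import Data.List.Relation.Unary.All as All using (All; []; _∷_)
import Data.List.Relation.Unary.All.Properties as AllP
import Data.List.Properties as ListP
open import Data.List.Effectful using (module MonadProperties)
open import Data.Nat as ℕ using (ℕ; zero; suc; _∸_; _≡ᵇ_; z≤n; s≤s)
import Data.Nat.Properties as ℕP
open import Data.Nat.ListAction using (sum)
open import Algebra.Properties.CommutativeSemigroup ℕP.+-commutativeSemigroup using () renaming (interchange to +-interchange)
open import Data.Product using (_×_; _,_; proj₁; proj₂)
open import Data.Rational using (ℚ; 0ℚ; 1ℚ; _+_; _*_; -_)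
import Data.Rational.Properties as ℚP
open import Data.Rational.Solver using (module +-*-Solver)
open import Relation.Binary.Bundles using (Setoid)
open import Relation.Binary.PropositionalEquality
import Relation.Binary.Reasoning.Setoid as SetoidReasoning

open +-*-Solver using (solve; _:+_; _:*_; :-_; _:=_; con)

eqW-refl : ∀ u → eqW u u ≡ true
eqW-refl ε       = refl
eqW-refl (u ▹ 𝕩) = eqW-refl u
eqW-refl (u ▹ 𝕪) = eqW-refl u

eqW⇒≡ : ∀ u v → eqW u v ≡ true → u ≡ v
eqW⇒≡ ε       ε       _ = refl
eqW⇒≡ (u ▹ 𝕩) (v ▹ 𝕩) e = cong (_▹ 𝕩) (eqW⇒≡ u v e)
eqW⇒≡ (u ▹ 𝕪) (v ▹ 𝕪) e = cong (_▹ 𝕪) (eqW⇒≡ u v e)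
eqW⇒≡ ε       (_ ▹ _) ()
eqW⇒≡ (_ ▹ _) ε       ()
eqW⇒≡ (_ ▹ 𝕩) (_ ▹ 𝕪) ()
eqW⇒≡ (_ ▹ 𝕪) (_ ▹ 𝕩) ()

eqW-sym : ∀ u v → eqW u v ≡ eqW v u
eqW-sym ε       ε       = refl
eqW-sym ε       (_ ▹ _) = refl
eqW-sym (_ ▹ _) ε       = refl
eqW-sym (u ▹ 𝕩) (v ▹ 𝕩) = eqW-sym u v
eqW-sym (_ ▹ 𝕩) (_ ▹ 𝕪) = refl
eqW-sym (_ ▹ 𝕪) (_ ▹ 𝕩) = refl
eqW-sym (u ▹ 𝕪) (v ▹ 𝕪) = eqW-sym u v

coeff-++ : ∀ p q w → coeff (p ++ q) w ≡ coeff p w + coeff q w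
coeff-++ []            q w = sym (ℚP.+-identityˡ (coeff q w))
coeff-++ ((c , u) ∷ p) q w =
  trans (cong (cᵤ +_) (coeff-++ p q w)) (sym (ℚP.+-assoc cᵤ (coeff p w) (coeff q w)))
  where cᵤ = if eqW u w then c else 0ℚ

coeff-scale : ∀ d p w → coeff (scale d p) w ≡ d * coeff p w
coeff-scale d []            w = sym (ℚP.*-zeroʳ d)
coeff-scale d ((c , u) ∷ p) w with eqW u w
... | true  = trans (cong (d * c +_) (coeff-scale d p w)) (sym (ℚP.*-distribˡ-+ d c (coeff p w)))
... | false = trans (ℚP.+-identityˡ _)
                (trans (coeff-scale d p w) (cong (d *_) (sym (ℚP.+-identityˡ _))))

-1*≡neg : ∀ x → - 1ℚ * x ≡ - x
-1*≡neg x = trans (sym (ℚP.neg-distribˡ-* 1ℚ x)) (cong -_ (ℚP.*-identityˡ x))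

coeff-neg : ∀ p w → coeff (neg p) w ≡ - coeff p w
coeff-neg p w = trans (coeff-scale (- 1ℚ) p w) (-1*≡neg (coeff p w))

coeff-·ℓ-ε : ∀ p a → coeff (p ·ℓ a) ε ≡ 0ℚ
coeff-·ℓ-ε []            a = refl
coeff-·ℓ-ε ((c , u) ∷ p) a = trans (ℚP.+-identityˡ _) (coeff-·ℓ-ε p a)

coeff-·ℓ-▹ : ∀ p a w b → coeff (p ·ℓ a) (w ▹ b) ≡ (if eqL a b then coeff p w else 0ℚ)
coeff-·ℓ-▹ [] a w b with eqL a b
... | true  = refl
... | false = refl
coeff-·ℓ-▹ ((c , u) ∷ p) a w b with eqL a b | coeff-·ℓ-▹ p a w b
... | true  | ih = cong ((if eqW u w then c else 0ℚ) +_) ih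
... | false | ih = trans (cong (0ℚ +_) ih) (ℚP.+-identityˡ 0ℚ)

-- p ≈H q is a function type from which Agda cannot recover p and q;
-- wrapped in a record they become inferable.
infix 4 _≋_
record _≋_ (p q : H) : Set where
  constructor coeffwise
  field coeff-≡ : p ≈H q
open _≋_ public

≋-refl : ∀ {p} → p ≋ p
≋-refl = coeffwise (λ _ → refl)

≋-sym : ∀ {p q} → p ≋ q → q ≋ p
≋-sym e = coeffwise (λ w → sym (coeff-≡ e w))

≋-trans : ∀ {p q r} → p ≋ q → q ≋ r → p ≋ r
≋-trans e f = coeffwise (λ w → trans (coeff-≡ e w) (coeff-≡ f w))

≡⇒≋ : ∀ {p q} → p ≡ q → p ≋ q
≡⇒≋ refl = ≋-refl

≋-setoid : Setoid _ _
≋-setoid = record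
  { Carrier       = H
  ; _≈_           = _≋_
  ; isEquivalence = record { refl = ≋-refl ; sym = ≋-sym ; trans = ≋-trans }
  }

module ≋-Reasoning = SetoidReasoning ≋-setoid

++-cong : ∀ {p p′ q q′} → p ≋ p′ → q ≋ q′ → p ++ q ≋ p′ ++ q′
++-cong {p} {p′} {q} {q′} e f = coeffwise λ w → begin
  coeff (p ++ q) w        ≡⟨ coeff-++ p q w ⟩
  coeff p w + coeff q w   ≡⟨ cong₂ _+_ (coeff-≡ e w) (coeff-≡ f w) ⟩
  coeff p′ w + coeff q′ w ≡⟨ coeff-++ p′ q′ w ⟨
  coeff (p′ ++ q′) w      ∎
  where open ≡-Reasoning

++-congˡ : ∀ p {q q′} → q ≋ q′ → p ++ q ≋ p ++ q′
++-congˡ p = ++-cong (≋-refl {p})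

++-congʳ : ∀ {p p′} q → p ≋ p′ → p ++ q ≋ p′ ++ q
++-congʳ q e = ++-cong e (≋-refl {q})

scale-cong : ∀ d {p q} → p ≋ q → scale d p ≋ scale d q
scale-cong d {p} {q} e = coeffwise λ w →
  trans (coeff-scale d p w) (trans (cong (d *_) (coeff-≡ e w)) (sym (coeff-scale d q w)))

neg-cong : ∀ {p q} → p ≋ q → neg p ≋ neg q
neg-cong = scale-cong (- 1ℚ)

scale-identity : ∀ p → scale 1ℚ p ≋ p
scale-identity p = coeffwise λ w → trans (coeff-scale 1ℚ p w) (ℚP.*-identityˡ (coeff p w))

·ℓ-cong : ∀ a {p q} → p ≋ q → p ·ℓ a ≋ q ·ℓ a
·ℓ-cong a {p} {q} e = coeffwise λ where
  ε       → trans (coeff-·ℓ-ε p a) (sym (coeff-·ℓ-ε q a))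
  (w ▹ b) → trans (coeff-·ℓ-▹ p a w b)
              (trans (cong (λ t → if eqL a b then t else 0ℚ) (coeff-≡ e w)) (sym (coeff-·ℓ-▹ q a w b)))

-- Composites of ++, neg and ·ℓ, whose coefficients coeffᴱ computes by
-- recursion, so that identities between them reduce to the ring solver.
infixl 6 _⊞_
infixl 7 _⊡_
data Expr : Set where
  atom : H → Expr
  _⊞_  : Expr → Expr → Expr
  ⊟_   : Expr → Expr
  _⊡_  : Expr → Letter → Expr

⟦_⟧ : Expr → H
⟦ atom p ⟧ = p
⟦ e ⊞ f ⟧  = ⟦ e ⟧ ++ ⟦ f ⟧
⟦ ⊟ e ⟧    = neg ⟦ e ⟧
⟦ e ⊡ a ⟧  = ⟦ e ⟧ ·ℓ a

coeffᴱ : Expr → Word → ℚ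
coeffᴱ (atom p) w       = coeff p w
coeffᴱ (e ⊞ f)  w       = coeffᴱ e w + coeffᴱ f w
coeffᴱ (⊟ e)    w       = - coeffᴱ e w
coeffᴱ (e ⊡ a)  ε       = 0ℚ
coeffᴱ (e ⊡ a)  (w ▹ b) = if eqL a b then coeffᴱ e w else 0ℚ

coeffᴱ-sound : ∀ e w → coeff ⟦ e ⟧ w ≡ coeffᴱ e w
coeffᴱ-sound (atom p) w       = refl
coeffᴱ-sound (e ⊞ f)  w       = trans (coeff-++ ⟦ e ⟧ ⟦ f ⟧ w) (cong₂ _+_ (coeffᴱ-sound e w) (coeffᴱ-sound f w))
coeffᴱ-sound (⊟ e)    w       = trans (coeff-neg ⟦ e ⟧ w) (cong -_ (coeffᴱ-sound e w))
coeffᴱ-sound (e ⊡ a)  ε       = coeff-·ℓ-ε ⟦ e ⟧ a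
coeffᴱ-sound (e ⊡ a)  (w ▹ b) =
  trans (coeff-·ℓ-▹ ⟦ e ⟧ a w b) (cong (λ t → if eqL a b then t else 0ℚ) (coeffᴱ-sound e w))

≋-by-coeffᴱ : ∀ e f → (∀ w → coeffᴱ e w ≡ coeffᴱ f w) → ⟦ e ⟧ ≋ ⟦ f ⟧
≋-by-coeffᴱ e f h = coeffwise λ w →
  trans (coeffᴱ-sound e w) (trans (h w) (sym (coeffᴱ-sound f w)))

≋-by-lastLetter : ∀ e f → coeffᴱ e ε ≡ coeffᴱ f ε →
                  (∀ t → coeffᴱ e (t ▹ 𝕩) ≡ coeffᴱ f (t ▹ 𝕩)) →
                  (∀ t → coeffᴱ e (t ▹ 𝕪) ≡ coeffᴱ f (t ▹ 𝕪)) → ⟦ e ⟧ ≋ ⟦ f ⟧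
≋-by-lastLetter e f hε h𝕩 h𝕪 = ≋-by-coeffᴱ e f λ where
  ε       → hε
  (t ▹ 𝕩) → h𝕩 t
  (t ▹ 𝕪) → h𝕪 t

coeffᴱ-≡ : ∀ e f → ⟦ e ⟧ ≋ ⟦ f ⟧ → ∀ w → coeffᴱ e w ≡ coeffᴱ f w
coeffᴱ-≡ e f eq w = trans (sym (coeffᴱ-sound e w)) (trans (coeff-≡ eq w) (coeffᴱ-sound f w))

++-comm : ∀ p q → p ++ q ≋ q ++ p
++-comm p q = ≋-by-coeffᴱ (atom p ⊞ atom q) (atom q ⊞ atom p) λ w → ℚP.+-comm (coeff p w) (coeff q w)

++-interchange : ∀ p q r s → (p ++ q) ++ (r ++ s) ≋ (p ++ r) ++ (q ++ s)
++-interchange p q r s =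
  ≋-by-coeffᴱ ((atom p ⊞ atom q) ⊞ (atom r ⊞ atom s)) ((atom p ⊞ atom r) ⊞ (atom q ⊞ atom s)) λ w →
    solve 4 (λ a b c d → (a :+ b) :+ (c :+ d) := (a :+ c) :+ (b :+ d)) refl
      (coeff p w) (coeff q w) (coeff r w) (coeff s w)

++-identityʳ : ∀ p → p ++ [] ≋ p
++-identityʳ p = ≡⇒≋ (ListP.++-identityʳ p)

extℚ : (Word → ℚ) → H → ℚ
extℚ F []            = 0ℚ
extℚ F ((c , u) ∷ p) = c * F u + extℚ F p

extℚ-++ : ∀ F p q → extℚ F (p ++ q) ≡ extℚ F p + extℚ F q
extℚ-++ F []            q = sym (ℚP.+-identityˡ _)
extℚ-++ F ((c , u) ∷ p) q =
  trans (cong (c * F u +_) (extℚ-++ F p q)) (sym (ℚP.+-assoc (c * F u) (extℚ F p) (extℚ F q)))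

extℚ-cong : ∀ {F G} → (∀ u → F u ≡ G u) → ∀ p → extℚ F p ≡ extℚ G p
extℚ-cong e []            = refl
extℚ-cong e ((c , u) ∷ p) = cong₂ _+_ (cong (c *_) (e u)) (extℚ-cong e p)

extℚ-+ : ∀ F G p → extℚ (λ u → F u + G u) p ≡ extℚ F p + extℚ G p
extℚ-+ F G []            = sym (ℚP.+-identityˡ 0ℚ)
extℚ-+ F G ((c , u) ∷ p) rewrite extℚ-+ F G p =
  solve 5 (λ c f g x y → c :* (f :+ g) :+ (x :+ y) := (c :* f :+ x) :+ (c :* g :+ y)) refl
    c (F u) (G u) (extℚ F p) (extℚ G p)

extℚ-* : ∀ d F p → extℚ (λ u → d * F u) p ≡ d * extℚ F p
extℚ-* d F []            = sym (ℚP.*-zeroʳ d)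
extℚ-* d F ((c , u) ∷ p) rewrite extℚ-* d F p =
  solve 4 (λ c d f x → c :* (d :* f) :+ d :* x := d :* (c :* f :+ x)) refl c d (F u) (extℚ F p)

extℚ-0 : ∀ p → extℚ (λ _ → 0ℚ) p ≡ 0ℚ
extℚ-0 []            = refl
extℚ-0 ((c , u) ∷ p) rewrite extℚ-0 p = trans (ℚP.+-identityʳ _) (ℚP.*-zeroʳ c)

extℚ-scale : ∀ d F p → extℚ F (scale d p) ≡ d * extℚ F p
extℚ-scale d F []            = sym (ℚP.*-zeroʳ d)
extℚ-scale d F ((c , u) ∷ p) rewrite extℚ-scale d F p =
  solve 4 (λ d c f x → d :* c :* f :+ d :* x := d :* (c :* f :+ x)) refl d c (F u) (extℚ F p)

extℚ-·ℓ : ∀ a F p → extℚ F (p ·ℓ a) ≡ extℚ (λ u → F (u ▹ a)) p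
extℚ-·ℓ a F []            = refl
extℚ-·ℓ a F ((c , u) ∷ p) = cong (c * F (u ▹ a) +_) (extℚ-·ℓ a F p)

extℚ-swap : ∀ (G : Word → Word → ℚ) p q →
            extℚ (λ u → extℚ (G u) q) p ≡ extℚ (λ v → extℚ (λ u → G u v) p) q
extℚ-swap G []            q = sym (extℚ-0 q)
extℚ-swap G ((c , u) ∷ p) q =
  trans (cong₂ _+_ (sym (extℚ-* c (G u) q)) (extℚ-swap G p q))
        (sym (extℚ-+ (λ v → c * G u v) (λ v → extℚ (λ u′ → G u′ v) p) q))

indicator : Word → Word → ℚ
indicator w u = if eqW u w then 1ℚ else 0ℚ

coeff-as-extℚ : ∀ p w → coeff p w ≡ extℚ (indicator w) p
coeff-as-extℚ []            w = refl
coeff-as-extℚ ((c , u) ∷ p) w with eqW u w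
... | true  = cong₂ _+_ (sym (ℚP.*-identityʳ c)) (coeff-as-extℚ p w)
... | false = cong₂ _+_ (sym (ℚP.*-zeroʳ c)) (coeff-as-extℚ p w)

delete : Word → H → H
delete u []            = []
delete u ((c , v) ∷ p) = if eqW u v then delete u p else (c , v) ∷ delete u p

extℚ-delete : ∀ F u p → extℚ F p ≡ coeff p u * F u + extℚ F (delete u p)
extℚ-delete F u [] = sym (trans (ℚP.+-identityʳ _) (ℚP.*-zeroˡ (F u)))
extℚ-delete F u ((c , v) ∷ p) with eqW u v in uv
... | true with refl ← eqW⇒≡ u v uv rewrite eqW-refl u | extℚ-delete F u p =
  solve 4 (λ c f k r → c :* f :+ (k :* f :+ r) := (c :+ k) :* f :+ r) refl
    c (F u) (coeff p u) (extℚ F (delete u p))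
... | false rewrite eqW-sym v u | uv | extℚ-delete F u p =
  solve 5 (λ c g f k r → c :* g :+ (k :* f :+ r) := (con 0ℚ :+ k) :* f :+ (c :* g :+ r)) refl
    c (F v) (F u) (coeff p u) (extℚ F (delete u p))

coeff-delete : ∀ u p w → coeff (delete u p) w ≡ (if eqW u w then 0ℚ else coeff p w)
coeff-delete u [] w with eqW u w
... | true  = refl
... | false = refl
coeff-delete u ((c , v) ∷ p) w with eqW u v in uv
... | true with refl ← eqW⇒≡ u v uv rewrite coeff-delete u p w with eqW u w
...   | true  = refl
...   | false = sym (ℚP.+-identityˡ _)
coeff-delete u ((c , v) ∷ p) w | false rewrite coeff-delete u p w with eqW u w in uw
...   | true with refl ← eqW⇒≡ u w uw rewrite eqW-sym v u | uv = ℚP.+-identityˡ 0ℚ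
...   | false = refl

delete-cong : ∀ u {p q} → p ≋ q → delete u p ≋ delete u q
delete-cong u {p} {q} e = coeffwise λ w →
  trans (coeff-delete u p w)
    (trans (cong (λ t → if eqW u w then 0ℚ else t) (coeff-≡ e w)) (sym (coeff-delete u q w)))

length-delete : ∀ u p → length (delete u p) ℕ.≤ length p
length-delete u []            = z≤n
length-delete u ((c , v) ∷ p) with eqW u v
... | true  = ℕP.m≤n⇒m≤1+n (length-delete u p)
... | false = s≤s (length-delete u p)

length-delete-head : ∀ u c p → length (delete u ((c , u) ∷ p)) ℕ.≤ length p
length-delete-head u c p rewrite eqW-refl u = length-delete u p

extℚ-resp-≋ : ∀ F {p q} → p ≋ q → extℚ F p ≡ extℚ F q
extℚ-resp-≋ F {p} {q} = go (length p ℕ.+ length q) p q ℕP.≤-refl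
  where
  peel : ∀ u p q → p ≋ q → extℚ F (delete u p) ≡ extℚ F (delete u q) → extℚ F p ≡ extℚ F q
  peel u p q e rest = begin
    extℚ F p                                    ≡⟨ extℚ-delete F u p ⟩
    coeff p u * F u + extℚ F (delete u p)       ≡⟨ cong₂ _+_ (cong (_* F u) (coeff-≡ e u)) rest ⟩
    coeff q u * F u + extℚ F (delete u q)       ≡⟨ extℚ-delete F u q ⟨
    extℚ F q                                    ∎
    where open ≡-Reasoning

  go : ∀ n p q → length p ℕ.+ length q ℕ.≤ n → p ≋ q → extℚ F p ≡ extℚ F q
  go _       []            []            _  _ = refl
  go (suc n) ((c , u) ∷ p) q             le e =
    peel u _ q e (go n _ _ (ℕP.≤-trans (ℕP.+-mono-≤ (length-delete-head u c p) (length-delete u q)) (ℕP.≤-pred le))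
                   (delete-cong u e))
  go (suc n) []            ((d , v) ∷ q) le e =
    peel v [] _ e (go n [] _ (ℕP.≤-trans (length-delete-head v d q) (ℕP.≤-pred le)) (delete-cong v e))

unit : Word → H
unit u = (1ℚ , u) ∷ []

coeff-unit : ∀ u w → coeff (unit u) w ≡ indicator w u
coeff-unit u w = ℚP.+-identityʳ _

extℚ-unit : ∀ F u → extℚ F (unit u) ≡ F u
extℚ-unit F u = trans (ℚP.+-identityʳ _) (ℚP.*-identityˡ (F u))

extH : (Word → H) → H → H
extH Φ []            = []
extH Φ ((c , u) ∷ p) = scale c (Φ u) ++ extH Φ p

coeff-extH : ∀ Φ p w → coeff (extH Φ p) w ≡ extℚ (λ u → coeff (Φ u) w) p
coeff-extH Φ []            w = refl
coeff-extH Φ ((c , u) ∷ p) w =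
  trans (coeff-++ (scale c (Φ u)) (extH Φ p) w) (cong₂ _+_ (coeff-scale c (Φ u) w) (coeff-extH Φ p w))

extH-++ : ∀ Φ p q → extH Φ (p ++ q) ≡ extH Φ p ++ extH Φ q
extH-++ Φ []            q = refl
extH-++ Φ ((c , u) ∷ p) q =
  trans (cong (scale c (Φ u) ++_) (extH-++ Φ p q)) (sym (ListP.++-assoc (scale c (Φ u)) (extH Φ p) (extH Φ q)))

extH-cong : ∀ {Φ Ψ} → (∀ u → Φ u ≋ Ψ u) → ∀ p → extH Φ p ≋ extH Ψ p
extH-cong {Φ} {Ψ} e p = coeffwise λ w →
  trans (coeff-extH Φ p w) (trans (extℚ-cong (λ u → coeff-≡ (e u) w) p) (sym (coeff-extH Ψ p w)))

extH-resp-≋ : ∀ Φ {p q} → p ≋ q → extH Φ p ≋ extH Φ q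
extH-resp-≋ Φ {p} {q} e = coeffwise λ w → begin
  coeff (extH Φ p) w              ≡⟨ coeff-extH Φ p w ⟩
  extℚ (λ u → coeff (Φ u) w) p    ≡⟨ extℚ-resp-≋ (λ u → coeff (Φ u) w) e ⟩
  extℚ (λ u → coeff (Φ u) w) q    ≡⟨ coeff-extH Φ q w ⟨
  coeff (extH Φ q) w              ∎
  where open ≡-Reasoning

extH-scale : ∀ Φ d p → extH Φ (scale d p) ≋ scale d (extH Φ p)
extH-scale Φ d p = coeffwise λ w → begin
  coeff (extH Φ (scale d p)) w              ≡⟨ coeff-extH Φ (scale d p) w ⟩
  extℚ (λ u → coeff (Φ u) w) (scale d p)    ≡⟨ extℚ-scale d _ p ⟩
  d * extℚ (λ u → coeff (Φ u) w) p          ≡⟨ cong (d *_) (coeff-extH Φ p w) ⟨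
  d * coeff (extH Φ p) w                    ≡⟨ coeff-scale d (extH Φ p) w ⟨
  coeff (scale d (extH Φ p)) w              ∎
  where open ≡-Reasoning

extH-++ᶠ : ∀ Φ Ψ p → extH (λ u → Φ u ++ Ψ u) p ≋ extH Φ p ++ extH Ψ p
extH-++ᶠ Φ Ψ []            = ≋-refl
extH-++ᶠ Φ Ψ ((c , u) ∷ p) = begin
  scale c (Φ u ++ Ψ u) ++ extH (λ u → Φ u ++ Ψ u) p
    ≈⟨ ++-cong (≡⇒≋ (ListP.map-++ _ (Φ u) (Ψ u))) (extH-++ᶠ Φ Ψ p) ⟩
  (scale c (Φ u) ++ scale c (Ψ u)) ++ (extH Φ p ++ extH Ψ p)
    ≈⟨ ++-interchange (scale c (Φ u)) (scale c (Ψ u)) (extH Φ p) (extH Ψ p) ⟩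
  (scale c (Φ u) ++ extH Φ p) ++ (scale c (Ψ u) ++ extH Ψ p)
    ∎
  where open ≋-Reasoning

-- Phrased through extH, linearity includes compatibility with ≋ (extH-resp-≋).
IsLinear : (H → H) → Set
IsLinear T = ∀ p → T p ≋ extH (λ u → T (unit u)) p

module _ {T : H → H} (T-linear : IsLinear T) where

  linear-cong : ∀ {p q} → p ≋ q → T p ≋ T q
  linear-cong {p} {q} e =
    ≋-trans (T-linear p) (≋-trans (extH-resp-≋ (λ u → T (unit u)) e) (≋-sym (T-linear q)))

  linear-++ : ∀ p q → T (p ++ q) ≋ T p ++ T q
  linear-++ p q = ≋-trans (T-linear (p ++ q))
    (≋-trans (≡⇒≋ (extH-++ _ p q)) (++-cong (≋-sym (T-linear p)) (≋-sym (T-linear q))))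

  linear-[] : T [] ≋ []
  linear-[] = T-linear []

  linear-scale : ∀ d p → T (scale d p) ≋ scale d (T p)
  linear-scale d p = ≋-trans (T-linear (scale d p))
    (≋-trans (extH-scale _ d p) (scale-cong d (≋-sym (T-linear p))))

  linear-neg : ∀ p → T (neg p) ≋ neg (T p)
  linear-neg = linear-scale (- 1ℚ)

  linear-extH : ∀ Ψ p → T (extH Ψ p) ≋ extH (λ u → T (Ψ u)) p
  linear-extH Ψ []            = linear-[]
  linear-extH Ψ ((c , u) ∷ p) =
    ≋-trans (linear-++ _ _) (++-cong (linear-scale c (Ψ u)) (linear-extH Ψ p))

  linear-∘ : ∀ {S} → IsLinear S → IsLinear (λ p → T (S p))
  linear-∘ S-linear p = ≋-trans (linear-cong (S-linear p)) (linear-extH _ p)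

  linear-ext : ∀ {S} → IsLinear S → (∀ u → T (unit u) ≋ S (unit u)) → ∀ p → T p ≋ S p
  linear-ext S-linear e p = ≋-trans (T-linear p) (≋-trans (extH-cong e p) (≋-sym (S-linear p)))

  linear-+ : ∀ {S} → IsLinear S → IsLinear (λ p → T p ++ S p)
  linear-+ S-linear p = ≋-trans (++-cong (T-linear p) (S-linear p)) (≋-sym (extH-++ᶠ _ _ p))

linear-by-coeff : ∀ {T} → (∀ p w → coeff (T p) w ≡ extℚ (λ u → coeff (T (unit u)) w) p) → IsLinear T
linear-by-coeff {T} h p = coeffwise λ w → trans (h p w) (sym (coeff-extH (λ u → T (unit u)) p w))

id-linear : IsLinear (λ p → p)
id-linear = linear-by-coeff λ p w →
  trans (coeff-as-extℚ p w) (extℚ-cong (λ u → sym (coeff-unit u w)) p)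

·ℓ-linear : ∀ a → IsLinear (_·ℓ a)
·ℓ-linear a = linear-by-coeff λ p w → begin
  coeff (p ·ℓ a) w                             ≡⟨ coeff-as-extℚ (p ·ℓ a) w ⟩
  extℚ (indicator w) (p ·ℓ a)                  ≡⟨ extℚ-·ℓ a (indicator w) p ⟩
  extℚ (λ u → indicator w (u ▹ a)) p           ≡⟨ extℚ-cong (λ u → sym (coeff-unit (u ▹ a) w)) p ⟩
  extℚ (λ u → coeff (unit u ·ℓ a) w) p         ∎
  where open ≡-Reasoning

scale-linear : ∀ d → IsLinear (scale d)
scale-linear d = linear-by-coeff λ p w → begin
  coeff (scale d p) w                          ≡⟨ coeff-scale d p w ⟩
  d * coeff p w                                ≡⟨ cong (d *_) (coeff-as-extℚ p w) ⟩
  d * extℚ (indicator w) p                     ≡⟨ extℚ-* d (indicator w) p ⟨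
  extℚ (λ u → d * indicator w u) p             ≡⟨ extℚ-cong (λ u → sym (trans (coeff-scale d (unit u) w) (cong (d *_) (coeff-unit u w)))) p ⟩
  extℚ (λ u → coeff (scale d (unit u)) w) p    ∎
  where open ≡-Reasoning

∑ : ℕ → (ℕ → H) → H
∑ zero    F = []
∑ (suc n) F = F 0 ++ ∑ n (λ k → F (suc k))

infixr 6 ∑
syntax ∑ n (λ k → e) = ∑[ k < n ] e

∑-cong-< : ∀ n {F G} → (∀ k → k ℕ.< n → F k ≋ G k) → ∑ n F ≋ ∑ n G
∑-cong-< zero    e = ≋-refl
∑-cong-< (suc n) e = ++-cong (e 0 (s≤s z≤n)) (∑-cong-< n (λ k k<n → e (suc k) (s≤s k<n)))

∑-cong : ∀ n {F G} → (∀ k → F k ≋ G k) → ∑ n F ≋ ∑ n G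
∑-cong n e = ∑-cong-< n (λ k _ → e k)

∑-zero : ∀ n {F} → (∀ k → k ℕ.< n → F k ≋ []) → ∑ n F ≋ []
∑-zero zero    e = ≋-refl
∑-zero (suc n) e = ++-cong (e 0 (s≤s z≤n)) (∑-zero n (λ k k<n → e (suc k) (s≤s k<n)))

∑-++ : ∀ n F G → ∑[ k < n ] (F k ++ G k) ≋ ∑ n F ++ ∑ n G
∑-++ zero    F G = ≋-refl
∑-++ (suc n) F G = ≋-trans (++-cong ≋-refl (∑-++ n _ _)) (++-interchange (F 0) (G 0) _ _)

∑-suc : ∀ n F → ∑ (suc n) F ≋ ∑ n F ++ F n
∑-suc zero    F = ++-identityʳ (F 0)
∑-suc (suc n) F =
  ≋-trans (++-cong (≋-refl {F 0}) (∑-suc n (λ k → F (suc k)))) (≡⇒≋ (sym (ListP.++-assoc (F 0) _ _)))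

∑-swap : ∀ m n (F : ℕ → ℕ → H) → ∑[ k < m ] ∑[ l < n ] F k l ≋ ∑[ l < n ] ∑[ k < m ] F k l
∑-swap zero    n F = ≋-sym (∑-zero n (λ _ _ → ≋-refl))
∑-swap (suc m) n F =
  ≋-trans (++-cong (≋-refl {∑ n (F 0)}) (∑-swap m n (λ k l → F (suc k) l)))
          (≋-sym (∑-++ n (F 0) (λ l → ∑[ k < m ] F (suc k) l)))

∑-triangle : ∀ N (Φ : ℕ → ℕ → H) →
             ∑[ K < N ] ∑[ m < K ] Φ K m ≋ ∑[ m < N ] ∑[ l < N ∸ suc m ] Φ (suc (m ℕ.+ l)) m
∑-triangle zero    Φ = ≋-refl
∑-triangle (suc N) Φ = begin
  ∑[ K < suc N ] ∑[ m < K ] Φ K m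
    ≈⟨ ∑-suc N (λ K → ∑[ m < K ] Φ K m) ⟩
  ∑[ K < N ] ∑[ m < K ] Φ K m ++ ∑[ m < N ] Φ N m
    ≈⟨ ++-congʳ (∑[ m < N ] Φ N m) (∑-triangle N Φ) ⟩
  ∑[ m < N ] ∑[ l < N ∸ suc m ] Φ (suc (m ℕ.+ l)) m ++ ∑[ m < N ] Φ N m
    ≈⟨ ∑-++ N (λ m → ∑[ l < N ∸ suc m ] Φ (suc (m ℕ.+ l)) m) (λ m → Φ N m) ⟨
  ∑[ m < N ] (∑[ l < N ∸ suc m ] Φ (suc (m ℕ.+ l)) m ++ Φ N m)
    ≈⟨ ∑-cong-< N row ⟩
  ∑[ m < N ] ∑[ l < N ∸ m ] Φ (suc (m ℕ.+ l)) m
    ≈⟨ ++-identityʳ _ ⟨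
  ∑[ m < N ] ∑[ l < N ∸ m ] Φ (suc (m ℕ.+ l)) m ++ []
    ≡⟨ cong (λ n → ∑[ m < N ] ∑[ l < N ∸ m ] Φ (suc (m ℕ.+ l)) m ++ ∑[ l < n ] Φ (suc (N ℕ.+ l)) N) (ℕP.n∸n≡0 N) ⟨
  ∑[ m < N ] ∑[ l < N ∸ m ] Φ (suc (m ℕ.+ l)) m ++ ∑[ l < N ∸ N ] Φ (suc (N ℕ.+ l)) N
    ≈⟨ ∑-suc N (λ m → ∑[ l < N ∸ m ] Φ (suc (m ℕ.+ l)) m) ⟨
  ∑[ m < suc N ] ∑[ l < suc N ∸ suc m ] Φ (suc (m ℕ.+ l)) m
    ∎
  where
  open ≋-Reasoning
  row : ∀ m → m ℕ.< N → ∑[ l < N ∸ suc m ] Φ (suc (m ℕ.+ l)) m ++ Φ N m ≋ ∑[ l < N ∸ m ] Φ (suc (m ℕ.+ l)) m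
  row m m<N = begin
    ∑[ l < N ∸ suc m ] Φ (suc (m ℕ.+ l)) m ++ Φ N m
      ≡⟨ cong (λ K → ∑[ l < N ∸ suc m ] Φ (suc (m ℕ.+ l)) m ++ Φ K m) (ℕP.m+[n∸m]≡n m<N) ⟨
    ∑[ l < N ∸ suc m ] Φ (suc (m ℕ.+ l)) m ++ Φ (suc (m ℕ.+ (N ∸ suc m))) m
      ≈⟨ ∑-suc (N ∸ suc m) (λ l → Φ (suc (m ℕ.+ l)) m) ⟨
    ∑[ l < suc (N ∸ suc m) ] Φ (suc (m ℕ.+ l)) m
      ≡⟨ cong (λ n → ∑[ l < n ] Φ (suc (m ℕ.+ l)) m) (ℕP.+-∸-assoc 1 m<N) ⟨
    ∑[ l < N ∸ m ] Φ (suc (m ℕ.+ l)) m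
      ∎

∑-linear : ∀ {T} → IsLinear T → ∀ n F → T (∑ n F) ≋ ∑[ k < n ] T (F k)
∑-linear T-linear zero    F = linear-[] T-linear
∑-linear T-linear (suc n) F =
  ≋-trans (linear-++ T-linear _ _) (++-cong ≋-refl (∑-linear T-linear n (λ k → F (suc k))))

∑-neg : ∀ n F → ∑[ k < n ] neg (F k) ≋ neg (∑ n F)
∑-neg n F = ≋-sym (∑-linear (scale-linear (- 1ℚ)) n F)

∑-++-neg : ∀ n X Y Z → ∑[ k < n ] (X k ++ Y k ++ neg (Z k)) ≋ ∑ n X ++ ∑ n Y ++ neg (∑ n Z)
∑-++-neg n X Y Z = begin
  ∑[ k < n ] (X k ++ Y k ++ neg (Z k))        ≈⟨ ∑-++ n X (λ k → Y k ++ neg (Z k)) ⟩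
  ∑ n X ++ ∑[ k < n ] (Y k ++ neg (Z k))      ≈⟨ ++-congˡ (∑ n X) (∑-++ n Y (λ k → neg (Z k))) ⟩
  ∑ n X ++ ∑ n Y ++ ∑[ k < n ] neg (Z k)      ≈⟨ ++-congˡ (∑ n X) (++-congˡ (∑ n Y) (∑-neg n Z)) ⟩
  ∑ n X ++ ∑ n Y ++ neg (∑ n Z)               ∎
  where open ≋-Reasoning

concatMap-upTo : ∀ (F : ℕ → H) n → concatMap F (upTo n) ≡ ∑ n F
concatMap-upTo F n = go F (λ k → k) n
  where
  go : ∀ {A : Set} (F : A → H) (g : ℕ → A) n → concatMap F (applyUpTo g n) ≡ ∑[ k < n ] F (g k)
  go F g zero    = refl
  go F g (suc n) = cong (F (g 0) ++_) (go F (λ k → g (suc k)) n)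

concatMap-[] : ∀ {A : Set} (f : A → H) {xs} → All (λ x → f x ≡ []) xs → concatMap f xs ≡ []
concatMap-[] f []         = refl
concatMap-[] f (e ∷ es) = cong₂ _++_ e (concatMap-[] f es)

concatMap-cong-≋ : ∀ {A : Set} {f g : A → H} → (∀ x → f x ≋ g x) → ∀ xs → concatMap f xs ≋ concatMap g xs
concatMap-cong-≋ e []       = ≋-refl
concatMap-cong-≋ e (x ∷ xs) = ++-cong (e x) (concatMap-cong-≋ e xs)

concatMap-cong-All : ∀ {A : Set} {f g : A → H} {xs} → All (λ x → f x ≋ g x) xs → concatMap f xs ≋ concatMap g xs
concatMap-cong-All []       = ≋-refl
concatMap-cong-All (e ∷ es) = ++-cong e (concatMap-cong-All es)

concatMap-++ᶠ : ∀ {A : Set} (f g : A → H) xs → concatMap (λ x → f x ++ g x) xs ≋ concatMap f xs ++ concatMap g xs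
concatMap-++ᶠ f g []       = ≋-refl
concatMap-++ᶠ f g (x ∷ xs) =
  ≋-trans (++-congˡ (f x ++ g x) (concatMap-++ᶠ f g xs)) (++-interchange (f x) (g x) _ _)

concatMap-swap : ∀ {A B : Set} (G : A → B → H) xs ys →
                 concatMap (λ x → concatMap (G x) ys) xs ≋ concatMap (λ y → concatMap (λ x → G x y) xs) ys
concatMap-swap G []       ys = ≡⇒≋ (sym (concatMap-[] _ (All.universal (λ _ → refl) ys)))
concatMap-swap G (x ∷ xs) ys =
  ≋-trans (++-congˡ (concatMap (G x) ys) (concatMap-swap G xs ys))
          (≋-sym (concatMap-++ᶠ (G x) (λ y → concatMap (λ x′ → G x′ y) xs) ys))

linear-concatMap : ∀ {T} → IsLinear T → ∀ {A : Set} (f : A → H) xs → T (concatMap f xs) ≋ concatMap (λ x → T (f x)) xs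
linear-concatMap T-linear f []       = linear-[] T-linear
linear-concatMap T-linear f (x ∷ xs) =
  ≋-trans (linear-++ T-linear (f x) _) (++-congˡ _ (linear-concatMap T-linear f xs))

-- Unlike Data.Nat's _≤ᵇ_, this one reduces on suc m ≤ᵇ suc n.
_≤ᵇ_ : ℕ → ℕ → Bool
zero  ≤ᵇ n     = true
suc m ≤ᵇ zero  = false
suc m ≤ᵇ suc n = m ≤ᵇ n

≤ᵇ⇒≤ : ∀ m n → (m ≤ᵇ n) ≡ true → m ℕ.≤ n
≤ᵇ⇒≤ zero    n       _ = z≤n
≤ᵇ⇒≤ (suc m) (suc n) e = s≤s (≤ᵇ⇒≤ m n e)

∧-true⇒ : ∀ {β γ} → (β ∧ γ) ≡ true → (β ≡ true) × (γ ≡ true)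
∧-true⇒ {true} {true} _ = refl , refl

when : Bool → H → H
when true  p = p
when false _ = []

when-[] : ∀ β → when β [] ≡ []
when-[] true  = refl
when-[] false = refl

when-++ : ∀ β p q → when β (p ++ q) ≡ when β p ++ when β q
when-++ true  p q = refl
when-++ false p q = refl

when-cong : ∀ β {p q} → p ≋ q → when β p ≋ when β q
when-cong true  e = e
when-cong false e = ≋-refl

when-cong-true : ∀ β {p q} → (β ≡ true → p ≋ q) → when β p ≋ when β q
when-cong-true true  e = e refl
when-cong-true false e = ≋-refl

when-∧ : ∀ β γ p → when (β ∧ γ) p ≡ when β (when γ p)
when-∧ true  γ p = refl
when-∧ false γ p = refl

when-∧-∧ : ∀ β₁ γ₁ β₂ γ₂ p → when ((β₁ ∧ γ₁) ∧ (β₂ ∧ γ₂)) p ≡ when (β₁ ∧ β₂) (when (γ₁ ∧ γ₂) p)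
when-∧-∧ false γ₁    β₂    γ₂ p = refl
when-∧-∧ true  false β₂    γ₂ p = sym (when-[] β₂)
when-∧-∧ true  true  false γ₂ p = refl
when-∧-∧ true  true  true  γ₂ p = refl

when-concatMap : ∀ β {A : Set} (f : A → H) xs → when β (concatMap f xs) ≡ concatMap (λ x → when β (f x)) xs
when-concatMap true  f xs = refl
when-concatMap false f xs = sym (concatMap-[] _ (All.universal (λ _ → refl) xs))

∑-when : ∀ β n F → ∑[ k < n ] when β (F k) ≋ when β (∑ n F)
∑-when true  n F = ≋-refl
∑-when false n F = ∑-zero n (λ _ _ → ≋-refl)

∑-truncate : ∀ N a (X : ℕ → H) → a ℕ.≤ N → ∑[ k < N ] when (suc k ≤ᵇ a) (X k) ≋ ∑ a X
∑-truncate zero    zero    X _         = ≋-refl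
∑-truncate (suc N) zero    X _         = ∑-zero (suc N) (λ _ _ → ≋-refl)
∑-truncate (suc N) (suc a) X (s≤s a≤N) = ++-congˡ (X 0) (∑-truncate N a (λ k → X (suc k)) a≤N)

-- The product ⋄

coeff-concatMap-scaled : ∀ (g : ℚ × Word → H) q w c F → (∀ d v → coeff (g (d , v)) w ≡ (c * d) * F v) →
                         coeff (concatMap g q) w ≡ c * extℚ F q
coeff-concatMap-scaled g []            w c F h = sym (ℚP.*-zeroʳ c)
coeff-concatMap-scaled g ((d , v) ∷ q) w c F h =
  trans (coeff-++ (g (d , v)) (concatMap g q) w)
    (trans (cong₂ _+_ (h d v) (coeff-concatMap-scaled g q w c F h))
      (solve 4 (λ c d f r → c :* d :* f :+ c :* r := c :* (d :* f :+ r)) refl c d (F v) (extℚ F q)))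

coeff-⋄ : ∀ p q w → coeff (p ⋄ q) w ≡ extℚ (λ u → extℚ (λ v → coeff (diamW u v) w) q) p
coeff-⋄ []            q w = refl
coeff-⋄ ((c , u) ∷ p) q w =
  trans (coeff-++ (concatMap _ q) (p ⋄ q) w)
    (cong₂ _+_ (coeff-concatMap-scaled _ q w c (λ v → coeff (diamW u v) w)
                  (λ d v → coeff-scale (c * d) (diamW u v) w))
               (coeff-⋄ p q w))

⋄-linearˡ : ∀ q → IsLinear (_⋄ q)
⋄-linearˡ q = linear-by-coeff λ p w →
  trans (coeff-⋄ p q w)
    (extℚ-cong (λ u → sym (trans (coeff-⋄ (unit u) q w) (extℚ-unit (λ u′ → extℚ (λ v → coeff (diamW u′ v) w) q) u))) p)

⋄-linearʳ : ∀ p → IsLinear (p ⋄_)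
⋄-linearʳ p = linear-by-coeff λ q w → begin
  coeff (p ⋄ q) w                                             ≡⟨ coeff-⋄ p q w ⟩
  extℚ (λ u → extℚ (λ v → coeff (diamW u v) w) q) p          ≡⟨ extℚ-swap (λ u v → coeff (diamW u v) w) p q ⟩
  extℚ (λ v → extℚ (λ u → coeff (diamW u v) w) p) q          ≡⟨ extℚ-cong (λ v → sym (trans (coeff-⋄ p (unit v) w)
                                                                   (extℚ-cong (λ u → extℚ-unit (λ v′ → coeff (diamW u v′) w) v) p))) q ⟩
  extℚ (λ v → coeff (p ⋄ unit v) w) q                        ∎
  where open ≡-Reasoning

unit-⋄-unit : ∀ u v → unit u ⋄ unit v ≋ diamW u v
unit-⋄-unit u v = coeffwise λ w →
  trans (coeff-⋄ (unit u) (unit v) w)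
    (trans (extℚ-unit (λ u′ → extℚ (λ v′ → coeff (diamW u′ v′) w) (unit v)) u)
      (extℚ-unit (λ v′ → coeff (diamW u v′) w) v))

IsBilinear : (H → H → H) → Set
IsBilinear B = (∀ q → IsLinear (λ p → B p q)) × (∀ p → IsLinear (λ q → B p q))

⋄-bilinear : IsBilinear _⋄_
⋄-bilinear = ⋄-linearˡ , ⋄-linearʳ

bilinear-ext : ∀ {B C} → IsBilinear B → IsBilinear C →
               (∀ u v → B (unit u) (unit v) ≋ C (unit u) (unit v)) → ∀ p q → B p q ≋ C p q
bilinear-ext (Bˡ , Bʳ) (Cˡ , Cʳ) e p q =
  linear-ext (Bˡ q) (Cˡ q) (λ u → linear-ext (Bʳ (unit u)) (Cʳ (unit u)) (e u) q) p

⋄-cong : ∀ {p p′ q q′} → p ≋ p′ → q ≋ q′ → p ⋄ q ≋ p′ ⋄ q′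
⋄-cong {p′ = p′} {q = q} e f = ≋-trans (linear-cong (⋄-linearˡ q) e) (linear-cong (⋄-linearʳ p′) f)

diamW-εʳ : ∀ v → diamW v ε ≡ unit v
diamW-εʳ ε       = refl
diamW-εʳ (v ▹ a) = refl

⋄-identityˡ : ∀ q → 1H ⋄ q ≋ q
⋄-identityˡ = linear-ext (⋄-linearʳ 1H) id-linear (unit-⋄-unit ε)

⋄-identityʳ : ∀ p → p ⋄ 1H ≋ p
⋄-identityʳ = linear-ext (⋄-linearˡ 1H) id-linear (λ u → ≋-trans (unit-⋄-unit u ε) (≡⇒≋ (diamW-εʳ u)))

-- The second recursive call of diamondF receives the fuel len v + suc (len w)
-- rather than len (v ▹ a) + len w.
diamondF-shifted : ∀ a v w → diamondF (len v ℕ.+ suc (len w)) (v ▹ a) w ≡ diamW (v ▹ a) w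
diamondF-shifted a v w = cong (λ n → diamondF n (v ▹ a) w) (ℕP.+-suc (len v) (len w))

diamW-𝕩𝕩 : ∀ v w → diamW (v ▹ 𝕩) (w ▹ 𝕩) ≡ diamW v (w ▹ 𝕩) ·ℓ 𝕩 ++ neg (diamW (v ▹ 𝕪) w ·ℓ 𝕩)
diamW-𝕩𝕩 v w = cong (λ t → diamW v (w ▹ 𝕩) ·ℓ 𝕩 ++ neg (t ·ℓ 𝕩)) (diamondF-shifted 𝕪 v w)

diamW-𝕩𝕪 : ∀ v w → diamW (v ▹ 𝕩) (w ▹ 𝕪) ≡ diamW v (w ▹ 𝕪) ·ℓ 𝕩 ++ diamW (v ▹ 𝕩) w ·ℓ 𝕪
diamW-𝕩𝕪 v w = cong (λ t → diamW v (w ▹ 𝕪) ·ℓ 𝕩 ++ t ·ℓ 𝕪) (diamondF-shifted 𝕩 v w)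

diamW-𝕪𝕩 : ∀ v w → diamW (v ▹ 𝕪) (w ▹ 𝕩) ≡ diamW v (w ▹ 𝕩) ·ℓ 𝕪 ++ diamW (v ▹ 𝕪) w ·ℓ 𝕩
diamW-𝕪𝕩 v w = cong (λ t → diamW v (w ▹ 𝕩) ·ℓ 𝕪 ++ t ·ℓ 𝕩) (diamondF-shifted 𝕪 v w)

diamW-𝕪𝕪 : ∀ v w → diamW (v ▹ 𝕪) (w ▹ 𝕪) ≡ diamW v (w ▹ 𝕪) ·ℓ 𝕪 ++ neg (diamW (v ▹ 𝕩) w ·ℓ 𝕪)
diamW-𝕪𝕪 v w = cong (λ t → diamW v (w ▹ 𝕪) ·ℓ 𝕪 ++ neg (t ·ℓ 𝕪)) (diamondF-shifted 𝕩 v w)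

infixl 8 _·z
_·z : H → H
p ·z = p ·ℓ 𝕩 ++ p ·ℓ 𝕪

_⊡z : Expr → Expr
e ⊡z = e ⊡ 𝕩 ⊞ e ⊡ 𝕪

·z-linear : IsLinear _·z
·z-linear = linear-+ (·ℓ-linear 𝕩) (·ℓ-linear 𝕪)

·z-cong : ∀ {p q} → p ≋ q → p ·z ≋ q ·z
·z-cong = linear-cong ·z-linear

diamW-·zˡ : ∀ v w → diamW (v ▹ 𝕩) w ++ diamW (v ▹ 𝕪) w ≋ diamW v w ·z
diamW-·zˡ v ε rewrite diamW-εʳ v = ≋-refl
diamW-·zˡ v (w ▹ 𝕩) =
  ≋-trans (≡⇒≋ (cong₂ _++_ (diamW-𝕩𝕩 v w) (diamW-𝕪𝕩 v w)))
    (≋-by-lastLetter ((A ⊡ 𝕩 ⊞ ⊟ (B ⊡ 𝕩)) ⊞ (A ⊡ 𝕪 ⊞ B ⊡ 𝕩)) (A ⊡z) refl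
      (λ t → solve 2 (λ a b → (a :+ :- b) :+ (con 0ℚ :+ b) := a :+ con 0ℚ) refl (coeffᴱ A t) (coeffᴱ B t))
      (λ t → solve 1 (λ a → (con 0ℚ :+ :- con 0ℚ) :+ (a :+ con 0ℚ) := con 0ℚ :+ a) refl (coeffᴱ A t)))
  where
  A = atom (diamW v (w ▹ 𝕩))
  B = atom (diamW (v ▹ 𝕪) w)
diamW-·zˡ v (w ▹ 𝕪) =
  ≋-trans (≡⇒≋ (cong₂ _++_ (diamW-𝕩𝕪 v w) (diamW-𝕪𝕪 v w)))
    (≋-by-lastLetter ((A ⊡ 𝕩 ⊞ B ⊡ 𝕪) ⊞ (A ⊡ 𝕪 ⊞ ⊟ (B ⊡ 𝕪))) (A ⊡z) refl
      (λ t → solve 1 (λ a → (a :+ con 0ℚ) :+ (con 0ℚ :+ :- con 0ℚ) := a :+ con 0ℚ) refl (coeffᴱ A t))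
      (λ t → solve 2 (λ a b → (con 0ℚ :+ b) :+ (a :+ :- b) := con 0ℚ :+ a) refl (coeffᴱ A t) (coeffᴱ B t)))
  where
  A = atom (diamW v (w ▹ 𝕪))
  B = atom (diamW (v ▹ 𝕩) w)

diamW-·zʳ : ∀ v w → diamW v (w ▹ 𝕩) ++ diamW v (w ▹ 𝕪) ≋ diamW v w ·z
diamW-·zʳ ε       w = ≋-refl
diamW-·zʳ (v ▹ 𝕩) w =
  ≋-trans (≡⇒≋ (cong₂ _++_ (diamW-𝕩𝕩 v w) (diamW-𝕩𝕪 v w)))
    (≋-by-lastLetter ((D₁ ⊡ 𝕩 ⊞ ⊟ (D₂ ⊡ 𝕩)) ⊞ (D₃ ⊡ 𝕩 ⊞ D₄ ⊡ 𝕪)) (D₄ ⊡z) refl h𝕩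
      (λ t → solve 1 (λ d → (con 0ℚ :+ :- con 0ℚ) :+ (con 0ℚ :+ d) := con 0ℚ :+ d) refl (coeffᴱ D₄ t)))
  where
  D₁ = atom (diamW v (w ▹ 𝕩))
  D₂ = atom (diamW (v ▹ 𝕪) w)
  D₃ = atom (diamW v (w ▹ 𝕪))
  D₄ = atom (diamW (v ▹ 𝕩) w)
  both-·z : ∀ t → coeffᴱ D₁ t + coeffᴱ D₃ t ≡ coeffᴱ D₄ t + coeffᴱ D₂ t
  both-·z = coeffᴱ-≡ (D₁ ⊞ D₃) (D₄ ⊞ D₂) (≋-trans (diamW-·zʳ v w) (≋-sym (diamW-·zˡ v w)))
  h𝕩 : ∀ t → (coeffᴱ D₁ t + - coeffᴱ D₂ t) + (coeffᴱ D₃ t + 0ℚ) ≡ coeffᴱ D₄ t + 0ℚ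
  h𝕩 t = begin
    (d₁ + - d₂) + (d₃ + 0ℚ)  ≡⟨ solve 3 (λ a b c → (a :+ :- b) :+ (c :+ con 0ℚ) := (a :+ c) :+ :- b) refl d₁ d₂ d₃ ⟩
    (d₁ + d₃) + - d₂         ≡⟨ cong (_+ - d₂) (both-·z t) ⟩
    (d₄ + d₂) + - d₂         ≡⟨ solve 2 (λ d b → (d :+ b) :+ :- b := d :+ con 0ℚ) refl d₄ d₂ ⟩
    d₄ + 0ℚ                  ∎
    where
    open ≡-Reasoning
    d₁ = coeffᴱ D₁ t
    d₂ = coeffᴱ D₂ t
    d₃ = coeffᴱ D₃ t
    d₄ = coeffᴱ D₄ t
diamW-·zʳ (v ▹ 𝕪) w =
  ≋-trans (≡⇒≋ (cong₂ _++_ (diamW-𝕪𝕩 v w) (diamW-𝕪𝕪 v w)))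
    (≋-by-lastLetter ((D₁ ⊡ 𝕪 ⊞ D₂ ⊡ 𝕩) ⊞ (D₃ ⊡ 𝕪 ⊞ ⊟ (D₄ ⊡ 𝕪))) (D₂ ⊡z) refl
      (λ t → solve 1 (λ d → (con 0ℚ :+ d) :+ (con 0ℚ :+ :- con 0ℚ) := d :+ con 0ℚ) refl (coeffᴱ D₂ t))
      h𝕪)
  where
  D₁ = atom (diamW v (w ▹ 𝕩))
  D₂ = atom (diamW (v ▹ 𝕪) w)
  D₃ = atom (diamW v (w ▹ 𝕪))
  D₄ = atom (diamW (v ▹ 𝕩) w)
  both-·z : ∀ t → coeffᴱ D₁ t + coeffᴱ D₃ t ≡ coeffᴱ D₄ t + coeffᴱ D₂ t
  both-·z = coeffᴱ-≡ (D₁ ⊞ D₃) (D₄ ⊞ D₂) (≋-trans (diamW-·zʳ v w) (≋-sym (diamW-·zˡ v w)))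
  h𝕪 : ∀ t → (coeffᴱ D₁ t + 0ℚ) + (coeffᴱ D₃ t + - coeffᴱ D₄ t) ≡ 0ℚ + coeffᴱ D₂ t
  h𝕪 t = begin
    (d₁ + 0ℚ) + (d₃ + - d₄)  ≡⟨ solve 3 (λ a c d → (a :+ con 0ℚ) :+ (c :+ :- d) := (a :+ c) :+ :- d) refl d₁ d₃ d₄ ⟩
    (d₁ + d₃) + - d₄         ≡⟨ cong (_+ - d₄) (both-·z t) ⟩
    (d₄ + d₂) + - d₄         ≡⟨ solve 2 (λ d b → (d :+ b) :+ :- d := con 0ℚ :+ b) refl d₄ d₂ ⟩
    0ℚ + d₂                  ∎
    where
    open ≡-Reasoning
    d₁ = coeffᴱ D₁ t
    d₂ = coeffᴱ D₂ t
    d₃ = coeffᴱ D₃ t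
    d₄ = coeffᴱ D₄ t

diamW-𝕪𝕪-·z : ∀ u v → diamW (u ▹ 𝕪) (v ▹ 𝕪) ≋ (diamW u (v ▹ 𝕪) ++ diamW (u ▹ 𝕪) v ++ neg (diamW u v ·z)) ·ℓ 𝕪
diamW-𝕪𝕪-·z u v =
  ≋-trans (≡⇒≋ (diamW-𝕪𝕪 u v))
    (≋-by-lastLetter (D₁ ⊡ 𝕪 ⊞ ⊟ (D₄ ⊡ 𝕪)) ((D₁ ⊞ (D₂ ⊞ ⊟ Z)) ⊡ 𝕪) refl (λ t → refl) h𝕪)
  where
  D₁ = atom (diamW u (v ▹ 𝕪))
  D₂ = atom (diamW (u ▹ 𝕪) v)
  D₄ = atom (diamW (u ▹ 𝕩) v)
  Z  = atom (diamW u v ·z)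
  z-split : ∀ t → coeffᴱ Z t ≡ coeffᴱ D₄ t + coeffᴱ D₂ t
  z-split = coeffᴱ-≡ Z (D₄ ⊞ D₂) (≋-sym (diamW-·zˡ u v))
  h𝕪 : ∀ t → coeffᴱ D₁ t + - coeffᴱ D₄ t ≡ coeffᴱ D₁ t + (coeffᴱ D₂ t + - coeffᴱ Z t)
  h𝕪 t = begin
    d₁ + - d₄                   ≡⟨ solve 3 (λ a d b → a :+ :- d := a :+ (b :+ :- (d :+ b))) refl d₁ d₄ d₂ ⟩
    d₁ + (d₂ + - (d₄ + d₂))     ≡⟨ cong (λ s → d₁ + (d₂ + - s)) (z-split t) ⟨
    d₁ + (d₂ + - coeffᴱ Z t)    ∎
    where
    open ≡-Reasoning
    d₁ = coeffᴱ D₁ t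
    d₂ = coeffᴱ D₂ t
    d₄ = coeffᴱ D₄ t

bilinear-∘ˡ : ∀ {B S} → IsLinear S → IsBilinear B → IsBilinear (λ p q → B (S p) q)
bilinear-∘ˡ S-linear (Bˡ , Bʳ) = (λ q → linear-∘ (Bˡ q) S-linear) , (λ p → Bʳ _)

bilinear-∘ʳ : ∀ {B S} → IsLinear S → IsBilinear B → IsBilinear (λ p q → B p (S q))
bilinear-∘ʳ S-linear (Bˡ , Bʳ) = (λ q → Bˡ _) , (λ p → linear-∘ (Bʳ p) S-linear)

linear-∘-bilinear : ∀ {T B} → IsLinear T → IsBilinear B → IsBilinear (λ p q → T (B p q))
linear-∘-bilinear T-linear (Bˡ , Bʳ) = (λ q → linear-∘ T-linear (Bˡ q)) , (λ p → linear-∘ T-linear (Bʳ p))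

bilinear-++ : ∀ {B C} → IsBilinear B → IsBilinear C → IsBilinear (λ p q → B p q ++ C p q)
bilinear-++ (Bˡ , Bʳ) (Cˡ , Cʳ) = (λ q → linear-+ (Bˡ q) (Cˡ q)) , (λ p → linear-+ (Bʳ p) (Cʳ p))

·z-⋄ : ∀ p q → p ·z ⋄ q ≋ (p ⋄ q) ·z
·z-⋄ = bilinear-ext (bilinear-∘ˡ ·z-linear ⋄-bilinear) (linear-∘-bilinear ·z-linear ⋄-bilinear) λ u v → begin
  unit u ·z ⋄ unit v                                  ≈⟨ linear-++ (⋄-linearˡ (unit v)) (unit (u ▹ 𝕩)) (unit (u ▹ 𝕪)) ⟩
  unit (u ▹ 𝕩) ⋄ unit v ++ unit (u ▹ 𝕪) ⋄ unit v    ≈⟨ ++-cong (unit-⋄-unit (u ▹ 𝕩) v) (unit-⋄-unit (u ▹ 𝕪) v) ⟩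
  diamW (u ▹ 𝕩) v ++ diamW (u ▹ 𝕪) v                ≈⟨ diamW-·zˡ u v ⟩
  diamW u v ·z                                        ≈⟨ ·z-cong (unit-⋄-unit u v) ⟨
  (unit u ⋄ unit v) ·z                                ∎
  where open ≋-Reasoning

⋄-·z : ∀ p q → p ⋄ q ·z ≋ (p ⋄ q) ·z
⋄-·z = bilinear-ext (bilinear-∘ʳ ·z-linear ⋄-bilinear) (linear-∘-bilinear ·z-linear ⋄-bilinear) λ u v → begin
  unit u ⋄ unit v ·z                                  ≈⟨ linear-++ (⋄-linearʳ (unit u)) (unit (v ▹ 𝕩)) (unit (v ▹ 𝕪)) ⟩
  unit u ⋄ unit (v ▹ 𝕩) ++ unit u ⋄ unit (v ▹ 𝕪)    ≈⟨ ++-cong (unit-⋄-unit u (v ▹ 𝕩)) (unit-⋄-unit u (v ▹ 𝕪)) ⟩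
  diamW u (v ▹ 𝕩) ++ diamW u (v ▹ 𝕪)                ≈⟨ diamW-·zʳ u v ⟩
  diamW u v ·z                                        ≈⟨ ·z-cong (unit-⋄-unit u v) ⟨
  (unit u ⋄ unit v) ·z                                ∎
  where open ≋-Reasoning

·𝕪-⋄-·𝕪 : ∀ p q → (p ·ℓ 𝕪) ⋄ (q ·ℓ 𝕪) ≋ (p ⋄ (q ·ℓ 𝕪) ++ (p ·ℓ 𝕪) ⋄ q ++ neg ((p ⋄ q) ·z)) ·ℓ 𝕪
·𝕪-⋄-·𝕪 = bilinear-ext (bilinear-∘ˡ (·ℓ-linear 𝕪) (bilinear-∘ʳ (·ℓ-linear 𝕪) ⋄-bilinear))
  (linear-∘-bilinear (·ℓ-linear 𝕪)
    (bilinear-++ (bilinear-∘ʳ (·ℓ-linear 𝕪) ⋄-bilinear)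
      (bilinear-++ (bilinear-∘ˡ (·ℓ-linear 𝕪) ⋄-bilinear)
        (linear-∘-bilinear (scale-linear (- 1ℚ)) (linear-∘-bilinear ·z-linear ⋄-bilinear)))))
  λ u v → begin
    unit (u ▹ 𝕪) ⋄ unit (v ▹ 𝕪)
      ≈⟨ unit-⋄-unit (u ▹ 𝕪) (v ▹ 𝕪) ⟩
    diamW (u ▹ 𝕪) (v ▹ 𝕪)
      ≈⟨ diamW-𝕪𝕪-·z u v ⟩
    (diamW u (v ▹ 𝕪) ++ diamW (u ▹ 𝕪) v ++ neg (diamW u v ·z)) ·ℓ 𝕪
      ≈⟨ ·ℓ-cong 𝕪 (++-cong (unit-⋄-unit u (v ▹ 𝕪))
                     (++-cong (unit-⋄-unit (u ▹ 𝕪) v) (neg-cong (·z-cong (unit-⋄-unit u v))))) ⟨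
    (unit u ⋄ unit (v ▹ 𝕪) ++ unit (u ▹ 𝕪) ⋄ unit v ++ neg ((unit u ⋄ unit v) ·z)) ·ℓ 𝕪
      ∎
  where open ≋-Reasoning

infixl 8 _·z^_ _·zᵏy_

_·z^_ : H → ℕ → H
p ·z^ zero  = p
p ·z^ suc n = p ·z^ n ·z

·z^-linear : ∀ n → IsLinear (_·z^ n)
·z^-linear zero    = id-linear
·z^-linear (suc n) = linear-∘ ·z-linear (·z^-linear n)

·z^-+ : ∀ p m n → p ·z^ n ·z^ m ≡ p ·z^ (m ℕ.+ n)
·z^-+ p zero    n = refl
·z^-+ p (suc m) n = cong _·z (·z^-+ p m n)

·z^-⋄ : ∀ n p q → p ·z^ n ⋄ q ≋ (p ⋄ q) ·z^ n
·z^-⋄ zero    p q = ≋-refl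
·z^-⋄ (suc n) p q = ≋-trans (·z-⋄ (p ·z^ n) q) (·z-cong (·z^-⋄ n p q))

⋄-·z^ : ∀ n p q → p ⋄ q ·z^ n ≋ (p ⋄ q) ·z^ n
⋄-·z^ zero    p q = ≋-refl
⋄-·z^ (suc n) p q = ≋-trans (⋄-·z p (q ·z^ n)) (·z-cong (⋄-·z^ n p q))

_·zᵏy_ : H → ℕ → H
p ·zᵏy k = p ·z^ k ·ℓ 𝕪

·zᵏy-linear : ∀ k → IsLinear (_·zᵏy k)
·zᵏy-linear k = linear-∘ (·ℓ-linear 𝕪) (·z^-linear k)

·zᵏy-cong : ∀ k {p q} → p ≋ q → p ·zᵏy k ≋ q ·zᵏy k
·zᵏy-cong k = linear-cong (·zᵏy-linear k)

·zᵏy-⋄-·zᵏy : ∀ k l U W →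
  U ·zᵏy k ⋄ W ·zᵏy l ≋
  (U ⋄ W ·zᵏy l) ·zᵏy k ++ (U ·zᵏy k ⋄ W) ·zᵏy l ++ neg ((U ⋄ W) ·zᵏy suc (k ℕ.+ l))
·zᵏy-⋄-·zᵏy k l U W = begin
  U ·zᵏy k ⋄ W ·zᵏy l
    ≈⟨ ·𝕪-⋄-·𝕪 (U ·z^ k) (W ·z^ l) ⟩
  (U ·z^ k ⋄ W ·zᵏy l ++ U ·zᵏy k ⋄ W ·z^ l ++ neg ((U ·z^ k ⋄ W ·z^ l) ·z)) ·ℓ 𝕪
    ≈⟨ ·ℓ-cong 𝕪 (++-cong (·z^-⋄ k U (W ·zᵏy l)) (++-cong (⋄-·z^ l (U ·zᵏy k) W) (neg-cong (·z-cong U·zᵏ⋄W·zˡ)))) ⟩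
  ((U ⋄ W ·zᵏy l) ·z^ k ++ (U ·zᵏy k ⋄ W) ·z^ l ++ neg ((U ⋄ W) ·z^ l ·z^ k ·z)) ·ℓ 𝕪
    ≈⟨ linear-++ (·ℓ-linear 𝕪) ((U ⋄ W ·zᵏy l) ·z^ k) (Y ++ Z) ⟩
  (U ⋄ W ·zᵏy l) ·zᵏy k ++ (Y ++ Z) ·ℓ 𝕪
    ≈⟨ ++-cong ≋-refl (≋-trans (linear-++ (·ℓ-linear 𝕪) Y Z) (++-cong ≋-refl (linear-neg (·ℓ-linear 𝕪) (U⋄W·zˡ·zᵏ ·z)))) ⟩
  (U ⋄ W ·zᵏy l) ·zᵏy k ++ (U ·zᵏy k ⋄ W) ·zᵏy l ++ neg ((U ⋄ W) ·z^ l ·z^ k ·z ·ℓ 𝕪)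
    ≡⟨ cong (λ r → (U ⋄ W ·zᵏy l) ·zᵏy k ++ (U ·zᵏy k ⋄ W) ·zᵏy l ++ neg (r ·z ·ℓ 𝕪)) (·z^-+ (U ⋄ W) k l) ⟩
  (U ⋄ W ·zᵏy l) ·zᵏy k ++ (U ·zᵏy k ⋄ W) ·zᵏy l ++ neg ((U ⋄ W) ·zᵏy suc (k ℕ.+ l))
    ∎
  where
  open ≋-Reasoning
  U·zᵏ⋄W·zˡ : U ·z^ k ⋄ W ·z^ l ≋ (U ⋄ W) ·z^ l ·z^ k
  U·zᵏ⋄W·zˡ = ≋-trans (·z^-⋄ k U (W ·z^ l)) (linear-cong (·z^-linear k) (⋄-·z^ l U W))
  U⋄W·zˡ·zᵏ = (U ⋄ W) ·z^ l ·z^ k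
  Y = (U ·zᵏy k ⋄ W) ·z^ l
  Z = neg (U⋄W·zˡ·zᵏ ·z)

-- The operator R

RH-linear : IsLinear RH
RH-linear p = ≋-trans (≡⇒≋ (RH≡extH p)) (extH-cong (λ u → ≋-sym (RH-unit u)) p)
  where
  RH≡extH : ∀ p → RH p ≡ extH RW p
  RH≡extH []            = refl
  RH≡extH ((c , u) ∷ p) = cong (scale c (RW u) ++_) (RH≡extH p)
  RH-unit : ∀ u → RH (unit u) ≋ RW u
  RH-unit u = ≋-trans (++-identityʳ _) (coeffwise λ w → trans (coeff-scale 1ℚ (RW u) w) (ℚP.*-identityˡ _))

RH-·𝕪 : ∀ p → RH (p ·ℓ 𝕪) ≋ (p ·z ++ p ·ℓ 𝕪) ·ℓ 𝕪
RH-·𝕪 = linear-ext (linear-∘ RH-linear (·ℓ-linear 𝕪))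
                   (linear-∘ (·ℓ-linear 𝕪) (linear-+ ·z-linear (·ℓ-linear 𝕪)))
  λ u → coeffwise λ w → on-words (eqW (u ▹ 𝕩 ▹ 𝕪) w) (eqW (u ▹ 𝕪 ▹ 𝕪) w)
  where
  on-words : ∀ b₁ b₂ →
    (if b₁ then 1ℚ * 1ℚ else 0ℚ) + ((if b₂ then 1ℚ * (1ℚ + 1ℚ) else 0ℚ) + 0ℚ) ≡
    (if b₁ then 1ℚ else 0ℚ) + ((if b₂ then 1ℚ else 0ℚ) + ((if b₂ then 1ℚ else 0ℚ) + 0ℚ))
  on-words true  true  = refl
  on-words true  false = refl
  on-words false true  = refl
  on-words false false = refl

infixl 8 _·[z+y]^_
_·[z+y]^_ : H → ℕ → H
p ·[z+y]^ zero  = p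
p ·[z+y]^ suc m = (p ·[z+y]^ m) ·z ++ (p ·[z+y]^ m) ·ℓ 𝕪

Rpow-suc-1H : ∀ m → Rpow (suc m) 1H ≋ 1H ·[z+y]^ m ·ℓ 𝕪
Rpow-suc-1H zero    = ≋-refl
Rpow-suc-1H (suc m) = ≋-trans (linear-cong RH-linear (Rpow-suc-1H m)) (RH-·𝕪 (1H ·[z+y]^ m))

-- R^{m+1}(1) = (z+y)^m y; expanding the last factor z + y of (z+y)^m z^j
-- again and again gives the sum below.
Rpow-suc-1H-expansion : ∀ m → Rpow (suc m) 1H ≋ ∑[ k < suc m ] Rpow (m ∸ k) 1H ·zᵏy k
Rpow-suc-1H-expansion m = begin
  Rpow (suc m) 1H                                   ≈⟨ Rpow-suc-1H m ⟩
  1H ·[z+y]^ m ·zᵏy 0                               ≈⟨ expand m 0 ⟩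
  ∑[ k < suc m ] Rpow (m ∸ k) 1H ·zᵏy (k ℕ.+ 0)     ≈⟨ ∑-cong (suc m) (λ k → ≡⇒≋ (cong (Rpow (m ∸ k) 1H ·zᵏy_) (ℕP.+-identityʳ k))) ⟩
  ∑[ k < suc m ] Rpow (m ∸ k) 1H ·zᵏy k             ∎
  where
  open ≋-Reasoning
  expand : ∀ m j → 1H ·[z+y]^ m ·zᵏy j ≋ ∑[ k < suc m ] Rpow (m ∸ k) 1H ·zᵏy (k ℕ.+ j)
  expand zero    j = ≋-sym (++-identityʳ _)
  expand (suc m) j = begin
    (Q ·z ++ Q ·ℓ 𝕪) ·zᵏy j
      ≈⟨ linear-++ (·zᵏy-linear j) (Q ·z) (Q ·ℓ 𝕪) ⟩
    Q ·z ·zᵏy j ++ (Q ·ℓ 𝕪) ·zᵏy j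
      ≡⟨ cong (λ r → r ·ℓ 𝕪 ++ (Q ·ℓ 𝕪) ·zᵏy j) (trans (·z^-+ Q j 1) (cong (Q ·z^_) (ℕP.+-comm j 1))) ⟩
    Q ·zᵏy suc j ++ (Q ·ℓ 𝕪) ·zᵏy j
      ≈⟨ ++-cong (expand m (suc j)) (·zᵏy-cong j (≋-sym (Rpow-suc-1H m))) ⟩
    (∑[ k < suc m ] Rpow (m ∸ k) 1H ·zᵏy (k ℕ.+ suc j)) ++ Rpow (suc m) 1H ·zᵏy j
      ≈⟨ ++-comm (∑[ k < suc m ] Rpow (m ∸ k) 1H ·zᵏy (k ℕ.+ suc j)) (Rpow (suc m) 1H ·zᵏy j) ⟩
    Rpow (suc m) 1H ·zᵏy j ++ (∑[ k < suc m ] Rpow (m ∸ k) 1H ·zᵏy (k ℕ.+ suc j))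
      ≈⟨ ++-congˡ (Rpow (suc m) 1H ·zᵏy j) (∑-cong (suc m) (λ k → ≡⇒≋ (cong (Rpow (m ∸ k) 1H ·zᵏy_) (ℕP.+-suc k j)))) ⟩
    ∑[ k < suc (suc m) ] Rpow (suc m ∸ k) 1H ·zᵏy (k ℕ.+ j)
      ∎
    where Q = 1H ·[z+y]^ m

-- The recursion

recurrence : (ℕ → ℕ → H) → ℕ → ℕ → H
recurrence F a b =
  ∑[ k < a ] F (a ∸ suc k) b ·zᵏy k ++
  ∑[ l < b ] F a (b ∸ suc l) ·zᵏy l ++
  neg (∑[ k < a ] ∑[ l < b ] F (a ∸ suc k) (b ∸ suc l) ·zᵏy suc (k ℕ.+ l))

SatisfiesRecurrence : (ℕ → ℕ → H) → Set
SatisfiesRecurrence F = ∀ a b n → a ℕ.+ b ≡ suc n → F a b ≋ recurrence F a b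

recurrence-cong : ∀ {F G} a b → (∀ a′ b′ → a′ ℕ.+ b′ ℕ.< a ℕ.+ b → F a′ b′ ≋ G a′ b′) →
                  recurrence F a b ≋ recurrence G a b
recurrence-cong a b agree =
  ++-cong (∑-cong-< a λ k k<a → ·zᵏy-cong k (agree _ _ (ℕP.+-monoˡ-< b (decrease k<a))))
 (++-cong (∑-cong-< b λ l l<b → ·zᵏy-cong l (agree _ _ (ℕP.+-monoʳ-< a (decrease l<b))))
          (neg-cong (∑-cong-< a λ k k<a → ∑-cong-< b λ l l<b →
            ·zᵏy-cong (suc (k ℕ.+ l)) (agree _ _ (ℕP.+-mono-< (decrease k<a) (decrease l<b))))))
  where
  decrease : ∀ {k a} → k ℕ.< a → a ∸ suc k ℕ.< a
  decrease k<a = ℕP.∸-monoʳ-< (s≤s z≤n) k<a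

recurrence-unique : ∀ {F G} → F 0 0 ≋ G 0 0 → SatisfiesRecurrence F → SatisfiesRecurrence G →
                    ∀ a b → F a b ≋ G a b
recurrence-unique {F} {G} base F-rec G-rec a b = go (a ℕ.+ b) a b ℕP.≤-refl
  where
  go : ∀ N a b → a ℕ.+ b ℕ.≤ N → F a b ≋ G a b
  by-recurrence : ∀ a b n → a ℕ.+ b ≡ suc n → ∀ N → a ℕ.+ b ℕ.≤ suc N → F a b ≋ G a b

  go N       zero    zero    _  = base
  go zero    (suc a) b       ()
  go zero    zero    (suc b) ()
  go (suc N) (suc a) b       le = by-recurrence (suc a) b (a ℕ.+ b) refl N le
  go (suc N) zero    (suc b) le = by-recurrence zero (suc b) b refl N le

  by-recurrence a b n a+b≡ N le = begin
    F a b              ≈⟨ F-rec a b n a+b≡ ⟩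
    recurrence F a b   ≈⟨ recurrence-cong a b (λ a′ b′ lt → go N a′ b′ (ℕP.≤-pred (ℕP.≤-trans lt le))) ⟩
    recurrence G a b   ≈⟨ G-rec a b n a+b≡ ⟨
    G a b              ∎
    where open ≋-Reasoning

∑-⋄ʳ-·zᵏy : ∀ k A n F → ∑[ l < n ] (A ⋄ F l) ·zᵏy k ≋ (A ⋄ ∑ n F) ·zᵏy k
∑-⋄ʳ-·zᵏy k A n F =
  ≋-trans (≋-sym (∑-linear (·zᵏy-linear k) n (λ l → A ⋄ F l))) (·zᵏy-cong k (≋-sym (∑-linear (⋄-linearʳ A) n F)))

∑-⋄ˡ-·zᵏy : ∀ k B n F → ∑[ l < n ] (F l ⋄ B) ·zᵏy k ≋ (∑ n F ⋄ B) ·zᵏy k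
∑-⋄ˡ-·zᵏy k B n F =
  ≋-trans (≋-sym (∑-linear (·zᵏy-linear k) n (λ l → F l ⋄ B))) (·zᵏy-cong k (≋-sym (∑-linear (⋄-linearˡ B) n F)))

Rpow⋄Rpow : ℕ → ℕ → H
Rpow⋄Rpow a b = Rpow a 1H ⋄ Rpow b 1H

Rpow⋄Rpow-recurrence : SatisfiesRecurrence Rpow⋄Rpow
Rpow⋄Rpow-recurrence zero    zero    _ ()
Rpow⋄Rpow-recurrence zero    (suc n) _ _ = begin
  1H ⋄ Rpow (suc n) 1H                                  ≈⟨ ⋄-identityˡ (Rpow (suc n) 1H) ⟩
  Rpow (suc n) 1H                                       ≈⟨ Rpow-suc-1H-expansion n ⟩
  ∑[ l < suc n ] Rpow (n ∸ l) 1H ·zᵏy l                 ≈⟨ ∑-cong (suc n) (λ l → ·zᵏy-cong l (⋄-identityˡ (Rpow (n ∸ l) 1H))) ⟨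
  ∑[ l < suc n ] Rpow⋄Rpow 0 (n ∸ l) ·zᵏy l             ≈⟨ ++-identityʳ _ ⟨
  recurrence Rpow⋄Rpow zero (suc n)                     ∎
  where open ≋-Reasoning
Rpow⋄Rpow-recurrence (suc m) zero    _ _ = begin
  Rpow (suc m) 1H ⋄ 1H                                  ≈⟨ ⋄-identityʳ (Rpow (suc m) 1H) ⟩
  Rpow (suc m) 1H                                       ≈⟨ Rpow-suc-1H-expansion m ⟩
  ∑[ k < suc m ] Rpow (m ∸ k) 1H ·zᵏy k                 ≈⟨ ∑-cong (suc m) (λ k → ·zᵏy-cong k (⋄-identityʳ (Rpow (m ∸ k) 1H))) ⟨
  ∑[ k < suc m ] Rpow⋄Rpow (m ∸ k) 0 ·zᵏy k             ≈⟨ ++-identityʳ _ ⟨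
  ∑[ k < suc m ] Rpow⋄Rpow (m ∸ k) 0 ·zᵏy k ++ []       ≈⟨ ++-congˡ _ (neg-cong (∑-zero (suc m) (λ _ _ → ≋-refl))) ⟨
  recurrence Rpow⋄Rpow (suc m) zero                     ∎
  where open ≋-Reasoning
Rpow⋄Rpow-recurrence (suc m) (suc n) _ _ = begin
  Rpow (suc m) 1H ⋄ Rpow (suc n) 1H
    ≈⟨ ⋄-cong (Rpow-suc-1H-expansion m) (Rpow-suc-1H-expansion n) ⟩
  ∑A ⋄ ∑B
    ≈⟨ ∑-linear (⋄-linearˡ ∑B) (suc m) (λ k → A k ·zᵏy k) ⟩
  ∑[ k < suc m ] (A k ·zᵏy k ⋄ ∑B)
    ≈⟨ ∑-cong (suc m) (λ k → ∑-linear (⋄-linearʳ (A k ·zᵏy k)) (suc n) (λ l → B l ·zᵏy l)) ⟩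
  ∑[ k < suc m ] ∑[ l < suc n ] (A k ·zᵏy k ⋄ B l ·zᵏy l)
    ≈⟨ ∑-cong (suc m) (λ k → ∑-cong (suc n) (λ l → ·zᵏy-⋄-·zᵏy k l (A k) (B l))) ⟩
  ∑[ k < suc m ] ∑[ l < suc n ] (X k l ++ Y k l ++ neg (Z k l))
    ≈⟨ ∑-cong (suc m) (λ k → ∑-++-neg (suc n) (X k) (Y k) (Z k)) ⟩
  ∑[ k < suc m ] (∑ (suc n) (X k) ++ ∑ (suc n) (Y k) ++ neg (∑ (suc n) (Z k)))
    ≈⟨ ∑-++-neg (suc m) (λ k → ∑ (suc n) (X k)) (λ k → ∑ (suc n) (Y k)) (λ k → ∑ (suc n) (Z k)) ⟩
  ∑∑X ++ ∑∑Y ++ neg ∑∑Z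
    ≈⟨ ++-cong (∑-cong (suc m) ∑X) (++-congʳ (neg ∑∑Z) (≋-trans (∑-swap (suc m) (suc n) Y) (∑-cong (suc n) ∑Y))) ⟩
  recurrence Rpow⋄Rpow (suc m) (suc n)
    ∎
  where
  open ≋-Reasoning
  A B : ℕ → H
  A k = Rpow (m ∸ k) 1H
  B l = Rpow (n ∸ l) 1H
  ∑A ∑B : H
  ∑A = ∑[ k < suc m ] A k ·zᵏy k
  ∑B = ∑[ l < suc n ] B l ·zᵏy l
  X Y Z : ℕ → ℕ → H
  X k l = (A k ⋄ B l ·zᵏy l) ·zᵏy k
  Y k l = (A k ·zᵏy k ⋄ B l) ·zᵏy l
  Z k l = (A k ⋄ B l) ·zᵏy suc (k ℕ.+ l)
  ∑∑X ∑∑Y ∑∑Z : H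
  ∑∑X = ∑[ k < suc m ] ∑ (suc n) (X k)
  ∑∑Y = ∑[ k < suc m ] ∑ (suc n) (Y k)
  ∑∑Z = ∑[ k < suc m ] ∑ (suc n) (Z k)
  ∑X : ∀ k → ∑ (suc n) (X k) ≋ (A k ⋄ Rpow (suc n) 1H) ·zᵏy k
  ∑X k = ≋-trans (∑-⋄ʳ-·zᵏy k (A k) (suc n) (λ l → B l ·zᵏy l))
                 (·zᵏy-cong k (linear-cong (⋄-linearʳ (A k)) (≋-sym (Rpow-suc-1H-expansion n))))
  ∑Y : ∀ l → ∑[ k < suc m ] Y k l ≋ (Rpow (suc m) 1H ⋄ B l) ·zᵏy l
  ∑Y l = ≋-trans (∑-⋄ˡ-·zᵏy l (B l) (suc m) (λ k → A k ·zᵏy k))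
                 (·zᵏy-cong l (linear-cong (⋄-linearˡ (B l)) (≋-sym (Rpow-suc-1H-expansion m))))

-- Polynomials in X and Y

Term : Set
Term = ℚ × ℕ × ℕ × Word

infixl 7 _*ₜ_
_*ₜ_ : Term → Term → Term
(c , i , j , u) *ₜ (d , i′ , j′ , v) = (c * d , i ℕ.+ i′ , j ℕ.+ j′ , u ·w v)

1ₜ : Term
1ₜ = (1ℚ , 0 , 0 , ε)

·w-identityˡ : ∀ v → ε ·w v ≡ v
·w-identityˡ ε       = refl
·w-identityˡ (v ▹ a) = cong (_▹ a) (·w-identityˡ v)

·w-assoc : ∀ u v t → (u ·w v) ·w t ≡ u ·w (v ·w t)
·w-assoc u v ε       = refl
·w-assoc u v (t ▹ a) = cong (_▹ a) (·w-assoc u v t)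

*ₜ-assoc : ∀ s t r → (s *ₜ t) *ₜ r ≡ s *ₜ (t *ₜ r)
*ₜ-assoc (c , i , j , u) (d , i′ , j′ , v) (e , i″ , j″ , w) =
  cong₂ _,_ (ℚP.*-assoc c d e)
    (cong₂ _,_ (ℕP.+-assoc i i′ i″) (cong₂ _,_ (ℕP.+-assoc j j′ j″) (·w-assoc u v w)))

*ₜ-identityˡ : ∀ t → 1ₜ *ₜ t ≡ t
*ₜ-identityˡ (d , i , j , v) = cong₂ _,_ (ℚP.*-identityˡ d) (cong (λ w → i , j , w) (·w-identityˡ v))

*ₜ-identityʳ : ∀ t → t *ₜ 1ₜ ≡ t
*ₜ-identityʳ (c , i , j , u) =
  cong₂ _,_ (ℚP.*-identityʳ c) (cong₂ _,_ (ℕP.+-identityʳ i) (cong (_, u) (ℕP.+-identityʳ j)))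

convolve : ∀ {A : Set} → (A → A → A) → List A → List A → List A
convolve _∙_ p q = concatMap (λ s → map (s ∙_) q) p

convolve-assoc : ∀ {A : Set} (_∙_ : A → A → A) → (∀ s t r → (s ∙ t) ∙ r ≡ s ∙ (t ∙ r)) →
                 ∀ p q r → convolve _∙_ (convolve _∙_ p q) r ≡ convolve _∙_ p (convolve _∙_ q r)
convolve-assoc _∙_ ∙-assoc p q r = begin
  concatMap (λ t → map (t ∙_) r) (concatMap (λ s → map (s ∙_) q) p)
    ≡⟨ MonadProperties.associative p (λ s → map (s ∙_) q) (λ t → map (t ∙_) r) ⟨
  concatMap (λ s → concatMap (λ t → map (t ∙_) r) (map (s ∙_) q)) p
    ≡⟨ ListP.concatMap-cong (λ s → ListP.concatMap-map (λ t → map (t ∙_) r) (s ∙_) q) p ⟩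
  concatMap (λ s → concatMap (λ t → map ((s ∙ t) ∙_) r) q) p
    ≡⟨ ListP.concatMap-cong (λ s → ListP.concatMap-cong (λ t → ListP.map-cong (∙-assoc s t) r) q) p ⟩
  concatMap (λ s → concatMap (λ t → map (λ x → s ∙ (t ∙ x)) r) q) p
    ≡⟨ ListP.concatMap-cong (λ s → ListP.concatMap-cong (λ t → ListP.map-∘ r) q) p ⟩
  concatMap (λ s → concatMap (λ t → map (s ∙_) (map (t ∙_) r)) q) p
    ≡⟨ ListP.concatMap-cong (λ s → ListP.map-concatMap (s ∙_) (λ t → map (t ∙_) r) q) p ⟨
  concatMap (λ s → map (s ∙_) (concatMap (λ t → map (t ∙_) r) q)) p
    ∎
  where open ≡-Reasoning

mulP-assoc : ∀ p q r → mulP (mulP p q) r ≡ mulP p (mulP q r)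
mulP-assoc = convolve-assoc _*ₜ_ *ₜ-assoc

mulP-identityˡ : ∀ q → mulP 1P q ≡ q
mulP-identityˡ q =
  trans (ListP.++-identityʳ (map (1ₜ *ₜ_) q)) (trans (ListP.map-cong *ₜ-identityˡ q) (ListP.map-id q))

mulP-identityʳ : ∀ p → mulP p 1P ≡ p
mulP-identityʳ p =
  trans (ListP.concatMap-cong (λ t → cong (_∷ []) (*ₜ-identityʳ t)) p) (ListP.concatMap-pure p)

zseq-snoc : ∀ ks k → zseq (ks ++ k ∷ []) ≡ mulP (zseq ks) (zk k)
zseq-snoc []       k = trans (mulP-identityʳ (zk k)) (sym (mulP-identityˡ (zk k)))
zseq-snoc (k′ ∷ ks) k =
  trans (cong (mulP (zk k′)) (zseq-snoc ks k)) (sym (mulP-assoc (zk k′) (zseq ks) (zk k)))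

deg : Term → ℕ
deg (_ , i , j , _) = i ℕ.+ j

Homogeneous : ℕ → PolyH → Set
Homogeneous s = All (λ t → deg t ≡ s)

deg-*ₜ : ∀ s t → deg (s *ₜ t) ≡ deg s ℕ.+ deg t
deg-*ₜ (_ , i , j , _) (_ , i′ , j′ , _) = +-interchange i i′ j j′

mulP-homogeneous : ∀ {s t P Q} → Homogeneous s P → Homogeneous t Q → Homogeneous (s ℕ.+ t) (mulP P Q)
mulP-homogeneous hP hQ =
  AllP.concat⁺ (AllP.map⁺ (All.map (λ {x} dx →
    AllP.map⁺ (All.map (λ {y} dy → trans (deg-*ₜ x y) (cong₂ ℕ._+_ dx dy)) hQ)) hP))

Monomial : Set
Monomial = ℚ × ℕ × ℕ

degₘ : Monomial → ℕ
degₘ (_ , i , j) = i ℕ.+ j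

_⊗_ : Monomial → H → PolyH
(c , i , j) ⊗ h = map (λ { (d , w) → (c * d , i , j , w) }) h

fpoly-degree : ∀ k → All (λ m → degₘ m ≡ k) (fpoly k)
fpoly-degree k = ℕP.+-identityʳ k ∷ refl ∷
  AllP.map⁺ (AllP.map⁺ (AllP.applyUpTo⁺₁ (λ n → n) (k ∸ 1)
    (λ n<k-1 → ℕP.m+[n∸m]≡n (ℕP.≤-trans n<k-1 (ℕP.m∸n≤m k 1)))))

⊗-homogeneous : ∀ m h → Homogeneous (degₘ m) (m ⊗ h)
⊗-homogeneous (c , i , j) h = AllP.map⁺ (All.universal (λ _ → refl) h)

zk-homogeneous : ∀ k → Homogeneous k (zk k)
zk-homogeneous k = AllP.concat⁺ (AllP.map⁺ (All.map (λ {m} degₘ≡k →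
  subst (λ s → Homogeneous s (m ⊗ h)) degₘ≡k (⊗-homogeneous m h)) (fpoly-degree k)))
  where h = zpow (k ∸ 1) ·ℓ 𝕪

zseq-homogeneous : ∀ ks → Homogeneous (sum ks) (zseq ks)
zseq-homogeneous []       = refl ∷ []
zseq-homogeneous (k ∷ ks) = mulP-homogeneous (zk-homogeneous k) (zseq-homogeneous ks)

comps-sum : ∀ n → All (λ ks → sum ks ≡ n) (comps n)
comps-sum zero          = refl ∷ []
comps-sum (suc zero)    = refl ∷ []
comps-sum (suc (suc n)) =
  AllP.++⁺ (AllP.map⁺ (All.map (cong suc) (comps-sum (suc n))))
           (AllP.map⁺ (All.map (λ {ks} → incHead-sum ks) (comps-sum (suc n))))
  where
  incHead-sum : ∀ ks → sum ks ≡ suc n → sum (incHead ks) ≡ suc (suc n)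
  incHead-sum (k ∷ ks) e = cong suc e

≡ᵇ-true⇒≡ : ∀ m n → (m ≡ᵇ n) ≡ true → m ≡ n
≡ᵇ-true⇒≡ m n e = ℕP.≡ᵇ⇒≡ m n (subst T (sym e) tt)

coeffXY-off-degree : ∀ {s} P a b → Homogeneous s P → s ≢ a ℕ.+ b → coeffXY P a b ≡ []
coeffXY-off-degree []                    a b _         _  = refl
coeffXY-off-degree ((_ , i , j , _) ∷ P) a b (d ∷ hP) s≢ with i ≡ᵇ a in i≡a | j ≡ᵇ b in j≡b
... | true  | true  = ⊥-elim (s≢ (trans (sym d) (cong₂ ℕ._+_ (≡ᵇ-true⇒≡ i a i≡a) (≡ᵇ-true⇒≡ j b j≡b))))
... | true  | false = coeffXY-off-degree P a b hP s≢
... | false | _     = coeffXY-off-degree P a b hP s≢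

coeffZ : ℕ → ℕ → ℕ → H
coeffZ n a b = concatMap (λ ks → coeffXY (zseq ks) a b) (comps n)

coeffZ-off-degree : ∀ n a b → n ≢ a ℕ.+ b → coeffZ n a b ≡ []
coeffZ-off-degree n a b n≢ = concatMap-[] _ (All.map (λ {ks} sum≡n →
  coeffXY-off-degree (zseq ks) a b (zseq-homogeneous ks) (λ e → n≢ (trans (sym sum≡n) e))) (comps-sum n))

sumZ-homogeneous : ∀ a b → sumZ a b ≋ coeffZ (a ℕ.+ b) a b
sumZ-homogeneous a b = begin
  sumZ a b                                     ≡⟨ concatMap-upTo (λ n → coeffZ n a b) (suc (a ℕ.+ b)) ⟩
  ∑[ n < suc (a ℕ.+ b) ] coeffZ n a b          ≈⟨ ∑-suc (a ℕ.+ b) (λ n → coeffZ n a b) ⟩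
  ∑[ n < a ℕ.+ b ] coeffZ n a b ++ coeffZ (a ℕ.+ b) a b
    ≈⟨ ++-congʳ (coeffZ (a ℕ.+ b) a b) (∑-zero (a ℕ.+ b) (λ n n< → ≡⇒≋ (coeffZ-off-degree n a b (ℕP.<⇒≢ n<)))) ⟩
  coeffZ (a ℕ.+ b) a b                         ∎
  where open ≋-Reasoning

endingWith : (List ℕ → H) → ℕ → ℕ → H
endingWith F s n = concatMap (λ ks → F (ks ++ s ∷ [])) (comps n)

concatMap-comps-suc-suc : ∀ n (F : List ℕ → H) → concatMap F (comps (suc (suc n))) ≡
  concatMap (λ ks → F (1 ∷ ks)) (comps (suc n)) ++ concatMap (λ ks → F (incHead ks)) (comps (suc n))
concatMap-comps-suc-suc n F = trans (ListP.concatMap-++ F (map (1 ∷_) C) (map incHead C))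
  (cong₂ _++_ (ListP.concatMap-map F (1 ∷_) C) (ListP.concatMap-map F incHead C))
  where C = comps (suc n)

splitFirst : (List ℕ → H) → ℕ → ℕ → H
splitFirst F s n = endingWith (λ ks → F (1 ∷ ks)) s n ++ endingWith (λ ks → F (incHead ks)) s n

endingWith-suc-suc : ∀ F s n → endingWith F s (suc (suc n)) ≡ splitFirst F s (suc n)
endingWith-suc-suc F s n = begin
  endingWith F s (suc (suc n))
    ≡⟨ concatMap-comps-suc-suc n (λ ks → F (ks ++ s ∷ [])) ⟩
  endingWith (λ ks → F (1 ∷ ks)) s (suc n) ++ concatMap (λ ks → F (incHead ks ++ s ∷ [])) (comps (suc n))
    ≡⟨ cong (endingWith (λ ks → F (1 ∷ ks)) s (suc n) ++_)
         (cong concat (ListP.map-cong-local (All.map (λ {ks} → incHead-snoc ks) (comps-sum (suc n))))) ⟩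
  splitFirst F s (suc n)
    ∎
  where
  open ≡-Reasoning
  incHead-snoc : ∀ ks → sum ks ≡ suc n → F (incHead ks ++ s ∷ []) ≡ F (incHead (ks ++ s ∷ []))
  incHead-snoc (k ∷ ks) _ = refl

concatMap-comps-by-last : ∀ M F → concatMap F (comps (suc M)) ≋ ∑[ k < suc M ] endingWith F (suc k) (M ∸ k)
concatMap-comps-by-last zero    F = ≋-sym (++-identityʳ (F (1 ∷ []) ++ []))
concatMap-comps-by-last (suc M) F = begin
  concatMap F (comps (suc (suc M)))
    ≡⟨ concatMap-comps-suc-suc M F ⟩
  concatMap (λ ks → F (1 ∷ ks)) (comps (suc M)) ++ concatMap (λ ks → F (incHead ks)) (comps (suc M))
    ≈⟨ ++-cong (concatMap-comps-by-last M (λ ks → F (1 ∷ ks))) (concatMap-comps-by-last M (λ ks → F (incHead ks))) ⟩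
  ∑[ k < suc M ] endingWith (λ ks → F (1 ∷ ks)) (suc k) (M ∸ k) ++ ∑[ k < suc M ] endingWith (λ ks → F (incHead ks)) (suc k) (M ∸ k)
    ≈⟨ ∑-++ (suc M) (λ k → endingWith (λ ks → F (1 ∷ ks)) (suc k) (M ∸ k))
                    (λ k → endingWith (λ ks → F (incHead ks)) (suc k) (M ∸ k)) ⟨
  ∑[ k < suc M ] splitFirst F (suc k) (M ∸ k)
    ≈⟨ ∑-suc M (λ k → splitFirst F (suc k) (M ∸ k)) ⟩
  ∑[ k < M ] splitFirst F (suc k) (M ∸ k) ++ splitFirst F (suc M) (M ∸ M)
    ≈⟨ ++-cong (∑-cong-< M (λ k k<M → ≡⇒≋ (inner k k<M))) (≡⇒≋ last) ⟩
  ∑[ k < M ] S k ++ (S M ++ S (suc M))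
    ≡⟨ ListP.++-assoc (∑ M S) (S M) (S (suc M)) ⟨
  (∑[ k < M ] S k ++ S M) ++ S (suc M)
    ≈⟨ ++-congʳ (S (suc M)) (∑-suc M S) ⟨
  ∑[ k < suc M ] S k ++ S (suc M)
    ≈⟨ ∑-suc (suc M) S ⟨
  ∑[ k < suc (suc M) ] S k
    ∎
  where
  open ≋-Reasoning
  S : ℕ → H
  S k = endingWith F (suc k) (suc M ∸ k)
  inner : ∀ k → k ℕ.< M → splitFirst F (suc k) (M ∸ k) ≡ S k
  inner k k<M = trans (cong (splitFirst F (suc k)) M∸k≡)
    (trans (sym (endingWith-suc-suc F (suc k) (M ∸ suc k)))
           (cong (endingWith F (suc k)) (sym (trans (ℕP.+-∸-assoc 1 (ℕP.<⇒≤ k<M)) (cong suc M∸k≡)))))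
    where
    M∸k≡ : M ∸ k ≡ suc (M ∸ suc k)
    M∸k≡ = ℕP.+-∸-assoc 1 k<M
  last : splitFirst F (suc M) (M ∸ M) ≡ S M ++ S (suc M)
  last = trans (cong (splitFirst F (suc M)) (ℕP.n∸n≡0 M))
    (sym (cong₂ (λ m n → endingWith F (suc M) m ++ endingWith F (suc (suc M)) n) (ℕP.m+n∸n≡m 1 M) (ℕP.n∸n≡0 M)))

infixl 7 _*ₕ_
_*ₕ_ : ℚ × Word → ℚ × Word → ℚ × Word
(c , u) *ₕ (d , v) = (c * d , u ·w v)

*ₕ-assoc : ∀ s t r → (s *ₕ t) *ₕ r ≡ s *ₕ (t *ₕ r)
*ₕ-assoc (c , u) (d , v) (e , w) = cong₂ _,_ (ℚP.*-assoc c d e) (·w-assoc u v w)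

mulH-assoc : ∀ p q r → mulH (mulH p q) r ≡ mulH p (mulH q r)
mulH-assoc = convolve-assoc _*ₕ_ *ₕ-assoc

mulH-identityʳ : ∀ p → mulH p 1H ≡ p
mulH-identityʳ p =
  trans (ListP.concatMap-cong (λ { (c , u) → cong (λ d → (d , u) ∷ []) (ℚP.*-identityʳ c) }) p) (ListP.concatMap-pure p)

mulH-·ℓ : ∀ p q a → mulH p (q ·ℓ a) ≡ mulH p q ·ℓ a
mulH-·ℓ p q a = trans (ListP.concatMap-cong (λ s → trans (sym (ListP.map-∘ q)) (ListP.map-∘ q)) p)
                      (sym (ListP.map-concatMap _ (λ s → map (s *ₕ_) q) p))

mulH-zH : ∀ q → mulH q zH ≋ q ·z
mulH-zH []            = ≋-refl
mulH-zH ((c , v) ∷ q) = begin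
  (c * 1ℚ , v ▹ 𝕩) ∷ (c * 1ℚ , v ▹ 𝕪) ∷ mulH q zH
    ≡⟨ cong (λ d → (d , v ▹ 𝕩) ∷ (d , v ▹ 𝕪) ∷ mulH q zH) (ℚP.*-identityʳ c) ⟩
  vx ++ vy ++ mulH q zH
    ≈⟨ ++-congˡ vx (++-congˡ vy (mulH-zH q)) ⟩
  vx ++ vy ++ q ·ℓ 𝕩 ++ q ·ℓ 𝕪
    ≈⟨ ≋-by-coeffᴱ (atom vx ⊞ (atom vy ⊞ (atom (q ·ℓ 𝕩) ⊞ atom (q ·ℓ 𝕪))))
                   ((atom vx ⊞ atom (q ·ℓ 𝕩)) ⊞ (atom vy ⊞ atom (q ·ℓ 𝕪))) (λ w →
         solve 4 (λ a b c d → a :+ (b :+ (c :+ d)) := (a :+ c) :+ (b :+ d)) refl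
           (coeff vx w) (coeff vy w) (coeff (q ·ℓ 𝕩) w) (coeff (q ·ℓ 𝕪) w)) ⟩
  ((c , v) ∷ q) ·z
    ∎
  where
  open ≋-Reasoning
  vx = (c , v ▹ 𝕩) ∷ []
  vy = (c , v ▹ 𝕪) ∷ []

mulH-zpow : ∀ p k → mulH p (zpow k) ≋ p ·z^ k
mulH-zpow p zero    = ≡⇒≋ (mulH-identityʳ p)
mulH-zpow p (suc k) = begin
  mulH p (mulH (zpow k) zH)    ≡⟨ mulH-assoc p (zpow k) zH ⟨
  mulH (mulH p (zpow k)) zH    ≈⟨ mulH-zH (mulH p (zpow k)) ⟩
  mulH p (zpow k) ·z           ≈⟨ ·z-cong (mulH-zpow p k) ⟩
  p ·z^ k ·z                   ∎
  where open ≋-Reasoning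

mulH-zpow-𝕪 : ∀ p k → mulH p (zpow k ·ℓ 𝕪) ≋ p ·zᵏy k
mulH-zpow-𝕪 p k = ≋-trans (≡⇒≋ (mulH-·ℓ p (zpow k) 𝕪)) (·ℓ-cong 𝕪 (mulH-zpow p k))

+-≡ᵇ : ∀ m i a → (m ℕ.+ i ≡ᵇ a) ≡ (i ≤ᵇ a) ∧ (m ≡ᵇ a ∸ i)
+-≡ᵇ m zero    a       = cong (_≡ᵇ a) (ℕP.+-identityʳ m)
+-≡ᵇ m (suc i) zero    = cong (_≡ᵇ 0) (ℕP.+-suc m i)
+-≡ᵇ m (suc i) (suc a) = trans (cong (_≡ᵇ suc a) (ℕP.+-suc m i)) (+-≡ᵇ m i a)

coeffXY-++ : ∀ P Q a b → coeffXY (P ++ Q) a b ≡ coeffXY P a b ++ coeffXY Q a b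
coeffXY-++ []                    Q a b = refl
coeffXY-++ ((c , i , j , w) ∷ P) Q a b =
  trans (cong (_ ++_) (coeffXY-++ P Q a b)) (sym (ListP.++-assoc _ (coeffXY P a b) (coeffXY Q a b)))

coeffXY-concatMap : ∀ {A : Set} (f : A → PolyH) xs a b →
                    coeffXY (concatMap f xs) a b ≡ concatMap (λ x → coeffXY (f x) a b) xs
coeffXY-concatMap f []       a b = refl
coeffXY-concatMap f (x ∷ xs) a b =
  trans (coeffXY-++ (f x) (concatMap f xs) a b) (cong (coeffXY (f x) a b ++_) (coeffXY-concatMap f xs a b))

coeffXY-map-*ₜ-⊗ : ∀ c₀ i₀ j₀ u c i j h a b →
  coeffXY (map ((c₀ , i₀ , j₀ , u) *ₜ_) ((c , i , j) ⊗ h)) a b ≡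
  when ((i₀ ℕ.+ i ≡ᵇ a) ∧ (j₀ ℕ.+ j ≡ᵇ b)) (map (λ { (d , w) → (c₀ * (c * d) , u ·w w) }) h)
coeffXY-map-*ₜ-⊗ c₀ i₀ j₀ u c i j [] a b = sym (when-[] _)
coeffXY-map-*ₜ-⊗ c₀ i₀ j₀ u c i j ((d , w) ∷ h) a b
  with (i₀ ℕ.+ i ≡ᵇ a) ∧ (j₀ ℕ.+ j ≡ᵇ b) | coeffXY-map-*ₜ-⊗ c₀ i₀ j₀ u c i j h a b
... | true  | rest = cong (_ ∷_) rest
... | false | rest = rest

coeffXY-term-⊗ : ∀ c₀ i₀ j₀ u c i j h a b →
  coeffXY (map ((c₀ , i₀ , j₀ , u) *ₜ_) ((c , i , j) ⊗ h)) a b ≋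
  when (i ≤ᵇ a ∧ j ≤ᵇ b) (scale c (mulH (if (i₀ ≡ᵇ a ∸ i) ∧ (j₀ ≡ᵇ b ∸ j) then (c₀ , u) ∷ [] else []) h))
coeffXY-term-⊗ c₀ i₀ j₀ u c i j h a b = begin
  coeffXY (map ((c₀ , i₀ , j₀ , u) *ₜ_) ((c , i , j) ⊗ h)) a b
    ≡⟨ coeffXY-map-*ₜ-⊗ c₀ i₀ j₀ u c i j h a b ⟩
  when ((i₀ ℕ.+ i ≡ᵇ a) ∧ (j₀ ℕ.+ j ≡ᵇ b)) Y
    ≡⟨ cong₂ (λ β₁ β₂ → when (β₁ ∧ β₂) Y) (+-≡ᵇ i₀ i a) (+-≡ᵇ j₀ j b) ⟩
  when ((i ≤ᵇ a ∧ (i₀ ≡ᵇ a ∸ i)) ∧ (j ≤ᵇ b ∧ (j₀ ≡ᵇ b ∸ j))) Y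
    ≡⟨ when-∧-∧ (i ≤ᵇ a) (i₀ ≡ᵇ a ∸ i) (j ≤ᵇ b) (j₀ ≡ᵇ b ∸ j) Y ⟩
  when (i ≤ᵇ a ∧ j ≤ᵇ b) (when ((i₀ ≡ᵇ a ∸ i) ∧ (j₀ ≡ᵇ b ∸ j)) Y)
    ≡⟨ cong (when (i ≤ᵇ a ∧ j ≤ᵇ b)) (by-γ ((i₀ ≡ᵇ a ∸ i) ∧ (j₀ ≡ᵇ b ∸ j))) ⟩
  when (i ≤ᵇ a ∧ j ≤ᵇ b) (scale c (mulH (if (i₀ ≡ᵇ a ∸ i) ∧ (j₀ ≡ᵇ b ∸ j) then (c₀ , u) ∷ [] else []) h))
    ∎
  where
  open ≋-Reasoning
  Y = map (λ { (d , w) → (c₀ * (c * d) , u ·w w) }) h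
  by-γ : ∀ γ → when γ Y ≡ scale c (mulH (if γ then (c₀ , u) ∷ [] else []) h)
  by-γ false = refl
  by-γ true  = sym (trans (cong (scale c) (ListP.++-identityʳ _))
    (trans (sym (ListP.map-∘ h))
      (ListP.map-cong (λ { (d , w) → cong (_, u ·w w)
        (solve 3 (λ c c₀ d → c :* (c₀ :* d) := c₀ :* (c :* d)) refl c c₀ d) }) h)))

coeffXY-mulP-⊗ : ∀ P c i j h a b →
  coeffXY (mulP P ((c , i , j) ⊗ h)) a b ≋ when (i ≤ᵇ a ∧ j ≤ᵇ b) (scale c (mulH (coeffXY P (a ∸ i) (b ∸ j)) h))
coeffXY-mulP-⊗ []                       c i j h a b = ≡⇒≋ (sym (when-[] (i ≤ᵇ a ∧ j ≤ᵇ b)))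
coeffXY-mulP-⊗ ((c₀ , i₀ , j₀ , u) ∷ P) c i j h a b = begin
  coeffXY (map (t *ₜ_) (m ⊗ h) ++ mulP P (m ⊗ h)) a b
    ≡⟨ coeffXY-++ (map (t *ₜ_) (m ⊗ h)) (mulP P (m ⊗ h)) a b ⟩
  coeffXY (map (t *ₜ_) (m ⊗ h)) a b ++ coeffXY (mulP P (m ⊗ h)) a b
    ≈⟨ ++-cong (coeffXY-term-⊗ c₀ i₀ j₀ u c i j h a b) (coeffXY-mulP-⊗ P c i j h a b) ⟩
  when β (scale c (mulH X h)) ++ when β (scale c (mulH (coeffXY P a′ b′) h))
    ≡⟨ when-++ β _ _ ⟨
  when β (scale c (mulH X h) ++ scale c (mulH (coeffXY P a′ b′) h))
    ≡⟨ cong (when β) (ListP.map-++ _ (mulH X h) _) ⟨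
  when β (scale c (mulH X h ++ mulH (coeffXY P a′ b′) h))
    ≡⟨ cong (λ r → when β (scale c r)) (ListP.concatMap-++ _ X (coeffXY P a′ b′)) ⟨
  when β (scale c (mulH (X ++ coeffXY P a′ b′) h))
    ∎
  where
  open ≋-Reasoning
  t = (c₀ , i₀ , j₀ , u)
  m = (c , i , j)
  a′ = a ∸ i
  b′ = b ∸ j
  β = i ≤ᵇ a ∧ j ≤ᵇ b
  X = if (i₀ ≡ᵇ a′) ∧ (j₀ ≡ᵇ b′) then (c₀ , u) ∷ [] else []

-- If S a b is the coefficient of X^a Y^b in a series, shiftTerm k a b S m is
-- the coefficient of X^a Y^b in m · (that series) · z^k y.
shiftTerm : ℕ → ℕ → ℕ → (ℕ → ℕ → H) → Monomial → H
shiftTerm k a b S (c , i , j) = when (i ≤ᵇ a ∧ j ≤ᵇ b) (scale c (S (a ∸ i) (b ∸ j) ·zᵏy k))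

coeffXY-·zk : ∀ P k a b → coeffXY (mulP P (zk (suc k))) a b ≋ concatMap (shiftTerm k a b (coeffXY P)) (fpoly (suc k))
coeffXY-·zk P k a b = begin
  coeffXY (mulP P (concatMap (_⊗ h) F)) a b
    ≡⟨ cong (λ Q → coeffXY Q a b) (ListP.concatMap-cong (λ t → ListP.map-concatMap (t *ₜ_) (_⊗ h) F) P) ⟩
  coeffXY (concatMap (λ t → concatMap (λ m → map (t *ₜ_) (m ⊗ h)) F) P) a b
    ≡⟨ coeffXY-concatMap _ P a b ⟩
  concatMap (λ t → coeffXY (concatMap (λ m → map (t *ₜ_) (m ⊗ h)) F) a b) P
    ≡⟨ ListP.concatMap-cong (λ t → coeffXY-concatMap (λ m → map (t *ₜ_) (m ⊗ h)) F a b) P ⟩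
  concatMap (λ t → concatMap (λ m → coeffXY (map (t *ₜ_) (m ⊗ h)) a b) F) P
    ≈⟨ concatMap-swap (λ t m → coeffXY (map (t *ₜ_) (m ⊗ h)) a b) P F ⟩
  concatMap (λ m → concatMap (λ t → coeffXY (map (t *ₜ_) (m ⊗ h)) a b) P) F
    ≡⟨ ListP.concatMap-cong (λ m → coeffXY-concatMap (λ t → map (t *ₜ_) (m ⊗ h)) P a b) F ⟨
  concatMap (λ m → coeffXY (mulP P (m ⊗ h)) a b) F
    ≈⟨ concatMap-cong-≋ (λ { (c , i , j) → ≋-trans (coeffXY-mulP-⊗ P c i j h a b)
         (when-cong (i ≤ᵇ a ∧ j ≤ᵇ b) (scale-cong c (mulH-zpow-𝕪 (coeffXY P (a ∸ i) (b ∸ j)) k))) }) F ⟩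
  concatMap (shiftTerm k a b (coeffXY P)) F
    ∎
  where
  open ≋-Reasoning
  h = zpow k ·ℓ 𝕪
  F = fpoly (suc k)

-- The right-hand side

∸-+-∸ : ∀ {a b i j k M} → i ℕ.≤ a → j ℕ.≤ b → a ℕ.+ b ≡ suc M → i ℕ.+ j ≡ suc k → (a ∸ i) ℕ.+ (b ∸ j) ≡ M ∸ k
∸-+-∸ {a} {b} {i} {j} {k} {M} i≤a j≤b a+b≡ i+j≡ = begin
  x                  ≡⟨ ℕP.m+n∸n≡m x k ⟨
  x ℕ.+ k ∸ k        ≡⟨ cong (_∸ k) (ℕP.suc-injective (begin
    suc (x ℕ.+ k)                           ≡⟨ ℕP.+-suc x k ⟨
    x ℕ.+ suc k                             ≡⟨ cong (x ℕ.+_) i+j≡ ⟨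
    (a ∸ i) ℕ.+ (b ∸ j) ℕ.+ (i ℕ.+ j)       ≡⟨ +-interchange (a ∸ i) (b ∸ j) i j ⟩
    (a ∸ i) ℕ.+ i ℕ.+ ((b ∸ j) ℕ.+ j)       ≡⟨ cong₂ ℕ._+_ (ℕP.m∸n+n≡m i≤a) (ℕP.m∸n+n≡m j≤b) ⟩
    a ℕ.+ b                                 ≡⟨ a+b≡ ⟩
    suc M                                   ∎)) ⟩
  M ∸ k              ∎
  where
  open ≡-Reasoning
  x = (a ∸ i) ℕ.+ (b ∸ j)

endingWith-coeffXY : ∀ a b M k → a ℕ.+ b ≡ suc M →
  endingWith (λ ks → coeffXY (zseq ks) a b) (suc k) (M ∸ k) ≋ concatMap (shiftTerm k a b sumZ) (fpoly (suc k))
endingWith-coeffXY a b M k a+b≡ = begin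
  concatMap (λ ks → coeffXY (zseq (ks ++ suc k ∷ [])) a b) C
    ≡⟨ ListP.concatMap-cong (λ ks → cong (λ P → coeffXY P a b) (zseq-snoc ks (suc k))) C ⟩
  concatMap (λ ks → coeffXY (mulP (zseq ks) (zk (suc k))) a b) C
    ≈⟨ concatMap-cong-≋ (λ ks → coeffXY-·zk (zseq ks) k a b) C ⟩
  concatMap (λ ks → concatMap (shiftTerm k a b (coeffXY (zseq ks))) F) C
    ≈⟨ concatMap-swap (λ ks → shiftTerm k a b (coeffXY (zseq ks))) C F ⟩
  concatMap (λ m → concatMap (λ ks → shiftTerm k a b (coeffXY (zseq ks)) m) C) F
    ≈⟨ concatMap-cong-All (All.map (λ {m} → monomial m) (fpoly-degree (suc k))) ⟩
  concatMap (shiftTerm k a b sumZ) F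
    ∎
  where
  open ≋-Reasoning
  C = comps (M ∸ k)
  F = fpoly (suc k)
  monomial : ∀ m → degₘ m ≡ suc k →
             concatMap (λ ks → shiftTerm k a b (coeffXY (zseq ks)) m) C ≋ shiftTerm k a b sumZ m
  monomial (c , i , j) i+j≡ = begin
    concatMap (λ ks → when β (scale c (coeffXY (zseq ks) (a ∸ i) (b ∸ j) ·zᵏy k))) C
      ≡⟨ when-concatMap β (λ ks → scale c (coeffXY (zseq ks) (a ∸ i) (b ∸ j) ·zᵏy k)) C ⟨
    when β (concatMap (λ ks → scale c (coeffXY (zseq ks) (a ∸ i) (b ∸ j) ·zᵏy k)) C)
      ≈⟨ when-cong β (linear-concatMap (linear-∘ (scale-linear c) (·zᵏy-linear k)) _ C) ⟨
    when β (scale c (coeffZ (M ∸ k) (a ∸ i) (b ∸ j) ·zᵏy k))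
      ≈⟨ when-cong-true β (λ β≡ → scale-cong c (·zᵏy-cong k (≋-sym (≋-trans (sumZ-homogeneous (a ∸ i) (b ∸ j))
           (≡⇒≋ (cong (λ n → coeffZ n (a ∸ i) (b ∸ j)) (∸-+-∸ (≤ᵇ⇒≤ i a (proj₁ (∧-true⇒ β≡)))
                                                            (≤ᵇ⇒≤ j b (proj₂ (∧-true⇒ β≡))) a+b≡ i+j≡))))))) ⟩
    when β (scale c (sumZ (a ∸ i) (b ∸ j) ·zᵏy k))
      ∎
    where β = i ≤ᵇ a ∧ j ≤ᵇ b

concatMap-fpoly : ∀ k (G : Monomial → H) →
  concatMap G (fpoly (suc k)) ≡ G (1ℚ , suc k , 0) ++ G (1ℚ , 0 , suc k) ++ ∑[ m < k ] G (- 1ℚ , suc m , k ∸ m)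
concatMap-fpoly k G = cong (λ r → G (1ℚ , suc k , 0) ++ G (1ℚ , 0 , suc k) ++ r) (begin
  concatMap G (map (λ n → (- 1ℚ , n , suc k ∸ n)) (map suc (upTo k)))
    ≡⟨ ListP.concatMap-map G _ (map suc (upTo k)) ⟩
  concatMap (λ n → G (- 1ℚ , n , suc k ∸ n)) (map suc (upTo k))
    ≡⟨ ListP.concatMap-map _ suc (upTo k) ⟩
  concatMap (λ m → G (- 1ℚ , suc m , k ∸ m)) (upTo k)
    ≡⟨ concatMap-upTo (λ m → G (- 1ℚ , suc m , k ∸ m)) k ⟩
  ∑[ m < k ] G (- 1ℚ , suc m , k ∸ m)
    ∎)
  where open ≡-Reasoning

∑-shift-X : ∀ S a b M → a ℕ.≤ suc M →
  ∑[ k < suc M ] shiftTerm k a b S (1ℚ , suc k , 0) ≋ ∑[ k < a ] S (a ∸ suc k) b ·zᵏy k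
∑-shift-X S a b M a≤ = begin
  ∑[ k < suc M ] when (suc k ≤ᵇ a ∧ true) (scale 1ℚ (S (a ∸ suc k) b ·zᵏy k))
    ≈⟨ ∑-cong (suc M) (λ k → ≋-trans (≡⇒≋ (cong (λ β → when β (scale 1ℚ (S (a ∸ suc k) b ·zᵏy k)))
                                                (∧-identityʳ (suc k ≤ᵇ a))))
                                      (when-cong (suc k ≤ᵇ a) (scale-identity (S (a ∸ suc k) b ·zᵏy k)))) ⟩
  ∑[ k < suc M ] when (suc k ≤ᵇ a) (S (a ∸ suc k) b ·zᵏy k)
    ≈⟨ ∑-truncate (suc M) a (λ k → S (a ∸ suc k) b ·zᵏy k) a≤ ⟩
  ∑[ k < a ] S (a ∸ suc k) b ·zᵏy k
    ∎
  where open ≋-Reasoning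

∑-shift-Y : ∀ S a b M → b ℕ.≤ suc M →
  ∑[ k < suc M ] shiftTerm k a b S (1ℚ , 0 , suc k) ≋ ∑[ l < b ] S a (b ∸ suc l) ·zᵏy l
∑-shift-Y S a b M b≤ = begin
  ∑[ l < suc M ] when (suc l ≤ᵇ b) (scale 1ℚ (S a (b ∸ suc l) ·zᵏy l))
    ≈⟨ ∑-cong (suc M) (λ l → when-cong (suc l ≤ᵇ b) (scale-identity (S a (b ∸ suc l) ·zᵏy l))) ⟩
  ∑[ l < suc M ] when (suc l ≤ᵇ b) (S a (b ∸ suc l) ·zᵏy l)
    ≈⟨ ∑-truncate (suc M) b (λ l → S a (b ∸ suc l) ·zᵏy l) b≤ ⟩
  ∑[ l < b ] S a (b ∸ suc l) ·zᵏy l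
    ∎
  where open ≋-Reasoning

suc[k+l]∸k≡suc[l] : ∀ k l → suc (k ℕ.+ l) ∸ k ≡ suc l
suc[k+l]∸k≡suc[l] k l = trans (cong (_∸ k) (sym (ℕP.+-suc k l))) (ℕP.m+n∸m≡n k (suc l))

∑-shift-XY : ∀ S a b M → a ℕ.+ b ≡ suc M →
  ∑[ K < suc M ] ∑[ m < K ] shiftTerm K a b S (- 1ℚ , suc m , K ∸ m) ≋
  neg (∑[ k < a ] ∑[ l < b ] S (a ∸ suc k) (b ∸ suc l) ·zᵏy suc (k ℕ.+ l))
∑-shift-XY S a b M a+b≡ = begin
  ∑[ K < suc M ] ∑[ m < K ] shiftTerm K a b S (- 1ℚ , suc m , K ∸ m)
    ≈⟨ ∑-triangle (suc M) (λ K m → shiftTerm K a b S (- 1ℚ , suc m , K ∸ m)) ⟩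
  ∑[ k < suc M ] ∑[ l < M ∸ k ] shiftTerm (suc (k ℕ.+ l)) a b S (- 1ℚ , suc k , suc (k ℕ.+ l) ∸ k)
    ≈⟨ ∑-cong (suc M) (λ k → ∑-cong (M ∸ k) (λ l → ≡⇒≋ (trans
         (cong (λ t → when (suc k ≤ᵇ a ∧ t ≤ᵇ b) (neg (S (a ∸ suc k) (b ∸ t) ·zᵏy suc (k ℕ.+ l))))
               (suc[k+l]∸k≡suc[l] k l))
         (when-∧ (suc k ≤ᵇ a) (suc l ≤ᵇ b) (neg (W k l)))))) ⟩
  ∑[ k < suc M ] ∑[ l < M ∸ k ] when (suc k ≤ᵇ a) (when (suc l ≤ᵇ b) (neg (W k l)))
    ≈⟨ ∑-cong (suc M) (λ k → ∑-when (suc k ≤ᵇ a) (M ∸ k) (λ l → when (suc l ≤ᵇ b) (neg (W k l)))) ⟩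
  ∑[ k < suc M ] when (suc k ≤ᵇ a) (∑[ l < M ∸ k ] when (suc l ≤ᵇ b) (neg (W k l)))
    ≈⟨ ∑-truncate (suc M) a (λ k → ∑[ l < M ∸ k ] when (suc l ≤ᵇ b) (neg (W k l))) (subst (a ℕ.≤_) a+b≡ (ℕP.m≤m+n a b)) ⟩
  ∑[ k < a ] ∑[ l < M ∸ k ] when (suc l ≤ᵇ b) (neg (W k l))
    ≈⟨ ∑-cong-< a (λ k k<a → ∑-truncate (M ∸ k) b (λ l → neg (W k l)) (b≤M∸k k<a)) ⟩
  ∑[ k < a ] ∑[ l < b ] neg (W k l)
    ≈⟨ ∑-cong a (λ k → ∑-neg b (W k)) ⟩
  ∑[ k < a ] neg (∑[ l < b ] W k l)
    ≈⟨ ∑-neg a (λ k → ∑[ l < b ] W k l) ⟩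
  neg (∑[ k < a ] ∑[ l < b ] W k l)
    ∎
  where
  open ≋-Reasoning
  W : ℕ → ℕ → H
  W k l = S (a ∸ suc k) (b ∸ suc l) ·zᵏy suc (k ℕ.+ l)
  b≤M∸k : ∀ {k} → k ℕ.< a → b ℕ.≤ M ∸ k
  b≤M∸k {k} k<a = ℕP.m+n≤o⇒m≤o∸n b (ℕP.≤-pred
    (subst₂ ℕ._≤_ (cong suc (ℕP.+-comm k b)) a+b≡ (ℕP.+-monoˡ-≤ b k<a)))

-- Splitting f(k+1) into X^{k+1}, Y^{k+1} and the mixed monomials, the
-- coefficient of X^a Y^b in S · (z_1 + z_2 + ⋯) becomes the recurrence.
∑-shift-fpoly : ∀ S a b M → a ℕ.+ b ≡ suc M →
  ∑[ k < suc M ] concatMap (shiftTerm k a b S) (fpoly (suc k)) ≋ recurrence S a b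
∑-shift-fpoly S a b M a+b≡ = begin
  ∑[ k < suc M ] concatMap (shiftTerm k a b S) (fpoly (suc k))
    ≈⟨ ∑-cong (suc M) (λ k → ≡⇒≋ (concatMap-fpoly k (shiftTerm k a b S))) ⟩
  ∑[ k < suc M ] (X k ++ Y k ++ Z k)
    ≈⟨ ≋-trans (∑-++ (suc M) X (λ k → Y k ++ Z k)) (++-congˡ (∑ (suc M) X) (∑-++ (suc M) Y Z)) ⟩
  ∑ (suc M) X ++ ∑ (suc M) Y ++ ∑ (suc M) Z
    ≈⟨ ++-cong (∑-shift-X S a b M (subst (a ℕ.≤_) a+b≡ (ℕP.m≤m+n a b)))
               (++-cong (∑-shift-Y S a b M (subst (b ℕ.≤_) a+b≡ (ℕP.m≤n+m b a))) (∑-shift-XY S a b M a+b≡)) ⟩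
  recurrence S a b
    ∎
  where
  open ≋-Reasoning
  X Y Z : ℕ → H
  X k = shiftTerm k a b S (1ℚ , suc k , 0)
  Y k = shiftTerm k a b S (1ℚ , 0 , suc k)
  Z k = ∑[ m < k ] shiftTerm k a b S (- 1ℚ , suc m , k ∸ m)

sumZ-recurrence : SatisfiesRecurrence sumZ
sumZ-recurrence a b M a+b≡ = begin
  sumZ a b
    ≈⟨ sumZ-homogeneous a b ⟩
  coeffZ (a ℕ.+ b) a b
    ≡⟨ cong (λ n → coeffZ n a b) a+b≡ ⟩
  coeffZ (suc M) a b
    ≈⟨ concatMap-comps-by-last M (λ ks → coeffXY (zseq ks) a b) ⟩
  ∑[ k < suc M ] endingWith (λ ks → coeffXY (zseq ks) a b) (suc k) (M ∸ k)
    ≈⟨ ∑-cong (suc M) (λ k → endingWith-coeffXY a b M k a+b≡) ⟩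
  ∑[ k < suc M ] concatMap (shiftTerm k a b sumZ) (fpoly (suc k))
    ≈⟨ ∑-shift-fpoly sumZ a b M a+b≡ ⟩
  recurrence sumZ a b
    ∎
  where open ≋-Reasoning

diamPS-geom : ∀ a b → diamPS geomRX geomRY a b ≋ Rpow⋄Rpow a b
diamPS-geom a b = begin
  diamPS geomRX geomRY a b
    ≡⟨ concatMap-upTo (λ i → concatMap (λ j → geomRX i j ⋄ geomRY (a ∸ i) (b ∸ j)) (upTo (suc b))) (suc a) ⟩
  ∑[ i < suc a ] concatMap (λ j → geomRX i j ⋄ geomRY (a ∸ i) (b ∸ j)) (upTo (suc b))
    ≈⟨ ∑-cong (suc a) (λ i → ≋-trans (≡⇒≋ (concatMap-upTo (λ j → geomRX i j ⋄ geomRY (a ∸ i) (b ∸ j)) (suc b)))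
                                     (≋-trans (++-congˡ _ (∑-zero b (λ _ _ → ≋-refl))) (++-identityʳ _))) ⟩
  ∑[ i < suc a ] Rpow i 1H ⋄ geomRY (a ∸ i) b
    ≈⟨ ∑-suc a (λ i → Rpow i 1H ⋄ geomRY (a ∸ i) b) ⟩
  ∑[ i < a ] Rpow i 1H ⋄ geomRY (a ∸ i) b ++ Rpow a 1H ⋄ geomRY (a ∸ a) b
    ≈⟨ ++-cong (∑-zero a vanishing) (≡⇒≋ (cong (λ n → Rpow a 1H ⋄ geomRY n b) (ℕP.n∸n≡0 a))) ⟩
  Rpow⋄Rpow a b
    ∎
  where
  open ≋-Reasoning
  vanishing : ∀ i → i ℕ.< a → Rpow i 1H ⋄ geomRY (a ∸ i) b ≋ []
  vanishing i i<a = ≋-trans (≡⇒≋ (cong (λ n → Rpow i 1H ⋄ geomRY n b) (ℕP.+-∸-assoc 1 i<a)))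
                            (linear-[] (⋄-linearʳ (Rpow i 1H)))

lemma5p1 : ∀ (a b : ℕ) → diamPS geomRX geomRY a b ≈H sumZ a b
lemma5p1 a b = coeff-≡ (begin
  diamPS geomRX geomRY a b   ≈⟨ diamPS-geom a b ⟩
  Rpow⋄Rpow a b              ≈⟨ recurrence-unique (⋄-identityˡ 1H) Rpow⋄Rpow-recurrence sumZ-recurrence a b ⟩
  sumZ a b                   ∎)
  where open ≋-Reasoning
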